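{- For all $n \ge 2$, $$|S_n(132, 54213, 2341)| = 3F_{n+5} - 2\binom{n+1}{3} - 4\binom{n+1}{2} - 3\binom{n+1}{1} - 14.$$ Moreover, the generating function $f(x) = \sum_{n=0}^\infty |S_n(132, 54213, 2341)|\, x^n$ is given by $$f(x) = \frac{x^7 - 3x^5 + x^4 + 2x^3 - 6x^2 + 4x - 1}{(x^2 + x - 1)(1 - x)^4}.$$
   Context: Permutations of $[n]$ are written in one-line notation, and $S_n$ denotes the set of them. A permutation $\pi\in S_n$ contains $\sigma\in S_m$ if there are indices $i_1<\dots<i_m$ such that for all $a,b$, $\pi(i_a)<\pi(i_b)$ iff $\sigma(a)<\sigma(b)$; otherwise $\pi$ avoids $\sigma$. For a set $R$ of permutations, $S_n(R)$ is the set of $\pi\in S_n$ avoiding every element of $R$; $S_0(R)$ consists of the empty permutation only. $F_n$ denotes the Fibonacci numbers with $F_0=0$, $F_1=F_2=1$, $F_n=F_{n-1}+F_{n-2}$. -}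

module Defs where

open import Data.Nat as ℕ using (ℕ; zero; suc)
open import Data.Nat.Combinatorics using (_C_)
open import Data.Integer as ℤ using (ℤ; +_; -[1+_])
open import Data.Fin as Fin using (Fin; #_)
open import Data.Vec using (Vec; []; _∷_; lookup)
open import Data.List using (List; length)
open import Data.List.Relation.Unary.Unique.Propositional using (Unique)
open import Data.List.Membership.Propositional using (_∈_)
open import Data.Product using (Σ; _×_)
open import Function.Bundles using (_⇔_)
open import Function.Definitions using (Injective)
open import Relation.Binary.PropositionalEquality using (_≡_)

-- A permutation of [n] in one-line notation: a vector of length n over Fin n
-- (values 0..n-1 standing for 1..n) whose entries are pairwise distinct.
IsPerm : ∀ {n} → Vec (Fin n) n → Set
IsPerm {n} v = Injective _≡_ _≡_ (lookup v)

Contains : ∀ {n m} → Vec (Fin n) n → Vec (Fin m) m → Set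
Contains {n} {m} π σ =
  Σ (Fin m → Fin n) λ f →
    (∀ a b → a Fin.< b → f a Fin.< f b) ×
    (∀ a b → (lookup π (f a) Fin.< lookup π (f b)) ⇔ (lookup σ a Fin.< lookup σ b))

Avoids : ∀ {n m} → Vec (Fin n) n → Vec (Fin m) m → Set
Avoids π σ = Contains π σ → Data.Empty.⊥
  where import Data.Empty

-- The patterns 132, 54213, 2341 (shifted to 0-based values).
p132 : Vec (Fin 3) 3
p132 = # 0 ∷ # 2 ∷ # 1 ∷ []

p54213 : Vec (Fin 5) 5
p54213 = # 4 ∷ # 3 ∷ # 1 ∷ # 0 ∷ # 2 ∷ []

p2341 : Vec (Fin 4) 4
p2341 = # 1 ∷ # 2 ∷ # 3 ∷ # 0 ∷ []

InS : (n : ℕ) → Vec (Fin n) n → Set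
InS n π = IsPerm π × Avoids π p132 × Avoids π p54213 × Avoids π p2341

HasCard : {A : Set} → (A → Set) → ℕ → Set
HasCard {A} P k =
  Σ (List A) λ xs → Unique xs × (∀ x → (x ∈ xs) ⇔ P x) × length xs ≡ k

fib : ℕ → ℕ
fib zero = 0
fib (suc zero) = 1
fib (suc (suc n)) = fib (suc n) ℕ.+ fib n

closedForm : ℕ → ℤ
closedForm n =
  + (3 ℕ.* fib (n ℕ.+ 5)) ℤ.- + (2 ℕ.* ((n ℕ.+ 1) C 3)) ℤ.- + (4 ℕ.* ((n ℕ.+ 1) C 2))
    ℤ.- + (3 ℕ.* ((n ℕ.+ 1) C 1)) ℤ.- + 14

Series : Set
Series = ℕ → ℤ

-- Polynomial from its coefficient list (constant term first).
poly : List ℤ → Series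
poly Data.List.[] _ = + 0
poly (c Data.List.∷ cs) zero = c
poly (c Data.List.∷ cs) (suc k) = poly cs k

sumTo : ℕ → (ℕ → ℤ) → ℤ
sumTo zero g = g 0
sumTo (suc n) g = sumTo n g ℤ.+ g (suc n)

_⋆_ : Series → Series → Series
(f ⋆ g) n = sumTo n (λ k → f k ℤ.* g (n ℕ.∸ k))
infixl 7 _⋆_

open Data.List using ([]; _∷_)

numerator : Series
numerator = poly (ℤ.- + 1 ∷ + 4 ∷ ℤ.- + 6 ∷ + 2 ∷ + 1 ∷ ℤ.- + 3 ∷ + 0 ∷ + 1 ∷ [])

oneMinusX : Series
oneMinusX = poly (+ 1 ∷ ℤ.- + 1 ∷ [])

denominator : Series
denominator = poly (ℤ.- + 1 ∷ + 1 ∷ + 1 ∷ []) ⋆ oneMinusX ⋆ oneMinusX ⋆ oneMinusX ⋆ oneMinusX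

-- A permutation of [0, m] avoiding 132 is α m β with α lying above β. If it also avoids 2341,
-- then either β is empty or α is the decreasing run m - 1, …, |β|; in the second case, avoiding
-- 54213 means that β avoids 4213, and also 213 once the run has length at least two. The
-- permutations avoiding 132, 2341 and 213 (resp. 4213) decompose in the same way, which gives
-- explicit lists 𝒜, ℬ, 𝒞 of the three classes and the recurrences b(n + 3) = 1 + b(n + 1) + b(n + 2),
-- c(n + 1) = c(n) + Σ b, a(n + 3) = a(n + 2) + Σ b + c(n + 1) + c(n + 2), solved by Fibonacci
-- numbers and binomial coefficients. On coefficients, the denominator (x² + x - 1)(1 - x)⁴ is
-- the Fibonacci recurrence followed by a fourth difference, which annihilates 3 F(n + 5) minus a
-- cubic polynomial in n.

module Submission where

open import Data.Nat using (ℕ; zero; suc; _≤_; _<_; _>_; z≤n; s≤s; _≟_; _<?_; _>?_; _≤?_)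
open import Data.Nat.Combinatorics using (_C_; nCk+nC[k+1]≡[n+1]C[k+1]; nC1≡n)
open import Data.Nat.Induction using (<-rec)
open import Data.Product using (Σ; ∃; ∃₂; _×_; _,_; proj₁; proj₂)
import Data.Product as Product
open import Data.Sum using (_⊎_; inj₁; inj₂)
open import Data.Empty using (⊥; ⊥-elim)
open import Data.Fin as Fin using (Fin; zero; suc; toℕ; fromℕ<)
open import Data.Fin.Properties as Fin using (toℕ<n; toℕ-injective; toℕ-fromℕ<)
open import Data.List as List using (List; []; _∷_; _++_; [_]; map; length; filter; upTo; applyUpTo; applyDownFrom)
open import Data.List.Properties
  using (map-++; ∷-injectiveˡ; ∷-injectiveʳ; ∷ʳ-injectiveˡ; ++-assoc; length-map; length-++; length-upTo;
         length-applyDownFrom; upTo-∷ʳ; length-tabulate; map-tabulate; tabulate-cong; map-id-local; map-∘)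
open import Data.List.Relation.Unary.All as All using (All; []; _∷_)
import Data.List.Relation.Unary.All.Properties as All
open import Data.List.Relation.Unary.AllPairs as AllPairs using (AllPairs; []; _∷_)
import Data.List.Relation.Unary.AllPairs.Properties as AllPairs
open import Data.List.Relation.Unary.Any using (here; there)
open import Data.List.Relation.Unary.Unique.Propositional using (Unique)
import Data.List.Relation.Unary.Unique.Propositional.Properties as Unique
open import Data.List.Membership.Propositional using (_∈_)
open import Data.List.Membership.Propositional.Properties
  using (∈-map⁺; ∈-map⁻; ∈-filter⁺; ∈-∃++; ∈-++⁺ˡ; ∈-++⁺ʳ; ∈-++⁻; ∈-upTo⁺; ∈-upTo⁻;
         ∈-applyDownFrom⁻)
open import Data.List.Membership.DecPropositional _≟_ using (_∈?_)
open import Data.List.Relation.Binary.Sublist.Propositional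
  using (_⊆_; []; _∷_; _∷ʳ_; ⊆-refl; ⊆-trans; minimum; from∈)
import Data.List.Relation.Binary.Sublist.Propositional.Properties as Sublist
open import Data.Vec as Vec using (Vec; lookup)
import Data.Vec.Properties as Vec
open import Data.Integer as ℤ using (+_)
open import Function.Bundles using (_⇔_; mk⇔; Equivalence)
open import Relation.Binary.Definitions using (tri<; tri≈; tri>)
open import Relation.Binary.PropositionalEquality
  using (_≡_; _≢_; refl; sym; trans; cong; cong₂; subst; subst₂; module ≡-Reasoning)
open import Relation.Nullary using (¬_; Dec; yes; no; _×-dec_)
open import Relation.Nullary.Decidable using (True; False; toWitness; toWitnessFalse)

open import Defs
  using (IsPerm; Contains; InS; HasCard; fib; closedForm; Series; sumTo; _⋆_; poly; oneMinusX; denominator; numerator)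
import Defs

module GeneratingFunction where

  open import Data.Integer using (ℤ; _+_; _-_; _*_; -_)
  open import Data.Integer.Properties using (pos-+; pos-*; +-identityʳ)
  open import Data.Integer.Tactic.RingSolver using (solve-∀)
  import Data.Nat as ℕ
  import Data.Nat.Properties as ℕ

  Δ : Series → Series
  Δ f n = f (suc n) - f n

  -- Δᵈ f vanishes: f is a polynomial of degree below d.
  data DegreeBelow : ℕ → Series → Set where
    vanishing  : ∀ {f} → (∀ n → f n ≡ + 0) → DegreeBelow 0 f
    difference : ∀ {d f} → DegreeBelow d (Δ f) → DegreeBelow (suc d) f

  degreeBelow-cong : ∀ {d f g} → (∀ n → f n ≡ g n) → DegreeBelow d f → DegreeBelow d g
  degreeBelow-cong f≗g (vanishing p)  = vanishing λ n → trans (sym (f≗g n)) (p n)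
  degreeBelow-cong f≗g (difference p) = difference (degreeBelow-cong (λ n → cong₂ _-_ (f≗g (suc n)) (f≗g n)) p)

  degreeBelow-suc : ∀ {d f} → DegreeBelow d f → DegreeBelow (suc d) f
  degreeBelow-suc (vanishing p)  = difference (vanishing λ n → cong₂ _-_ (p (suc n)) (p n))
  degreeBelow-suc (difference p) = difference (degreeBelow-suc p)

  degreeBelow-≤ : ∀ {d e f} → d ≤ e → DegreeBelow d f → DegreeBelow e f
  degreeBelow-≤ {e = zero}  z≤n       p              = p
  degreeBelow-≤ {e = suc e} z≤n       p              = degreeBelow-suc (degreeBelow-≤ z≤n p)
  degreeBelow-≤             (s≤s d≤e) (difference p) = difference (degreeBelow-≤ d≤e p)

  degreeBelow-shift : ∀ {d f} → DegreeBelow d f → DegreeBelow d (λ n → f (suc n))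
  degreeBelow-shift (vanishing p)  = vanishing λ n → p (suc n)
  degreeBelow-shift (difference p) = difference (degreeBelow-shift p)

  degreeBelow-+ : ∀ {d f g} → DegreeBelow d f → DegreeBelow d g → DegreeBelow d (λ n → f n + g n)
  degreeBelow-+ (vanishing p) (vanishing q) = vanishing λ n → cong₂ _+_ (p n) (q n)
  degreeBelow-+ {f = f} {g} (difference p) (difference q) =
    difference (degreeBelow-cong (λ n → Δ-+ (f n) (f (suc n)) (g n) (g (suc n))) (degreeBelow-+ p q))
    where Δ-+ : ∀ x x′ y y′ → (x′ - x) + (y′ - y) ≡ (x′ + y′) - (x + y)
          Δ-+ = solve-∀

  degreeBelow-* : ∀ {d f} a → DegreeBelow d f → DegreeBelow d (λ n → a * f n)
  degreeBelow-* a (vanishing p) = vanishing λ n → trans (cong (a *_) (p n)) (times-zero a)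
    where times-zero : ∀ a → a * + 0 ≡ + 0
          times-zero = solve-∀
  degreeBelow-* {f = f} a (difference p) =
    difference (degreeBelow-cong (λ n → Δ-* a (f n) (f (suc n))) (degreeBelow-* a p))
    where Δ-* : ∀ a x x′ → a * (x′ - x) ≡ a * x′ - a * x
          Δ-* = solve-∀

  binomial : ℕ → Series
  binomial r n = + ((n ℕ.+ 1) C r)

  binomial-degree : ∀ r → DegreeBelow (suc r) (binomial r)
  binomial-degree zero    = difference (vanishing λ n → cancel (+ 1))
    where cancel : ∀ x → x - x ≡ + 0
          cancel = solve-∀
  binomial-degree (suc r) = difference (degreeBelow-cong Δ-binomial (binomial-degree r))
    where
      cancel : ∀ x y → x ≡ (x + y) - y
      cancel = solve-∀
      Δ-binomial : ∀ n → binomial r n ≡ Δ (binomial (suc r)) n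
      Δ-binomial n = trans (cancel (binomial r n) (binomial (suc r) n)) (cong (_- binomial (suc r) n)
        (trans (sym (pos-+ ((n ℕ.+ 1) C r) ((n ℕ.+ 1) C suc r))) (cong +_ (nCk+nC[k+1]≡[n+1]C[k+1] (n ℕ.+ 1) r))))

  cubic : Series
  cubic n = + 2 * binomial 3 n + + 4 * binomial 2 n + + 3 * binomial 1 n + + 14 * binomial 0 n

  cubic-degree : DegreeBelow 4 cubic
  cubic-degree = sum (sum (sum (term 2 ℕ.≤-refl (binomial-degree 3)) (term 4 (ℕ.n≤1+n 3) (binomial-degree 2)))
                             (term 3 (s≤s (s≤s z≤n)) (binomial-degree 1)))
                        (term 14 (s≤s z≤n) (binomial-degree 0))
    where
      sum = degreeBelow-+
      term : ∀ {d} c {f} → d ≤ 4 → DegreeBelow d f → DegreeBelow 4 (λ n → + c * f n)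
      term c d≤4 p = degreeBelow-* (+ c) (degreeBelow-≤ d≤4 p)

  Φ : Series → Series
  Φ f n = f (2 ℕ.+ n) - f (1 ℕ.+ n) - f n

  degreeBelow-Φ : ∀ {d f} → DegreeBelow d f → DegreeBelow d (Φ f)
  degreeBelow-Φ {f = f} p = degreeBelow-cong (λ n → as-sum (f (2 ℕ.+ n)) (f (1 ℕ.+ n)) (f n))
    (degreeBelow-+ (degreeBelow-+ (degreeBelow-shift (degreeBelow-shift p)) (degreeBelow-* (- + 1) (degreeBelow-shift p)))
                   (degreeBelow-* (- + 1) p))
    where as-sum : ∀ x y z → x + - + 1 * y + - + 1 * z ≡ x - y - z
          as-sum = solve-∀

  fibonacci : Series
  fibonacci n = + fib (n ℕ.+ 5)

  Φ-fibonacci : ∀ n → Φ fibonacci n ≡ + 0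
  Φ-fibonacci n = trans (cong (λ z → z - + x - + y) (pos-+ x y)) (cancel (+ x) (+ y))
    where
      x = fib (suc (n ℕ.+ 5))
      y = fib (n ℕ.+ 5)
      cancel : ∀ x y → x + y - x - y ≡ + 0
      cancel = solve-∀

  closedForm-split : ∀ n → closedForm n ≡ + 3 * fibonacci n - cubic n
  closedForm-split n = trans
    (cong₂ _-_ (cong₂ _-_ (cong₂ _-_ (cong₂ _-_ (pos-* 3 f) (pos-* 2 c₃)) (pos-* 4 c₂)) (pos-* 3 c₁)) refl)
    (regroup (+ f) (+ c₃) (+ c₂) (+ c₁))
    where
      f  = fib (n ℕ.+ 5)
      c₃ = (n ℕ.+ 1) C 3
      c₂ = (n ℕ.+ 1) C 2
      c₁ = (n ℕ.+ 1) C 1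
      regroup : ∀ f c₃ c₂ c₁ → + 3 * f - + 2 * c₃ - + 4 * c₂ - + 3 * c₁ - + 14
                               ≡ + 3 * f - (+ 2 * c₃ + + 4 * c₂ + + 3 * c₁ + + 14 * + 1)
      regroup = solve-∀

  Φ-closedForm-degree : DegreeBelow 4 (Φ closedForm)
  Φ-closedForm-degree = degreeBelow-cong pointwise (degreeBelow-* (- + 1) (degreeBelow-Φ cubic-degree))
    where
      expand : ∀ f₂ f₁ f₀ c₂ c₁ c₀ → (+ 3 * f₂ - c₂) - (+ 3 * f₁ - c₁) - (+ 3 * f₀ - c₀)
                                     ≡ + 3 * (f₂ - f₁ - f₀) + - + 1 * (c₂ - c₁ - c₀)
      expand = solve-∀
      drop-zero : ∀ x → x ≡ + 3 * + 0 + x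
      drop-zero = solve-∀
      pointwise : ∀ n → - + 1 * Φ cubic n ≡ Φ closedForm n
      pointwise n = begin
        - + 1 * Φ cubic n
          ≡⟨ drop-zero (- + 1 * Φ cubic n) ⟩
        + 3 * + 0 + - + 1 * Φ cubic n
          ≡⟨ cong (λ z → + 3 * z + - + 1 * Φ cubic n) (sym (Φ-fibonacci n)) ⟩
        + 3 * Φ fibonacci n + - + 1 * Φ cubic n
          ≡⟨ sym (expand (fibonacci (2 ℕ.+ n)) (fibonacci (1 ℕ.+ n)) (fibonacci n)
                         (cubic (2 ℕ.+ n)) (cubic (1 ℕ.+ n)) (cubic n)) ⟩
        (+ 3 * fibonacci (2 ℕ.+ n) - cubic (2 ℕ.+ n)) - (+ 3 * fibonacci (1 ℕ.+ n) - cubic (1 ℕ.+ n))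
          - (+ 3 * fibonacci n - cubic n)
          ≡⟨ sym (cong₂ _-_ (cong₂ _-_ (closedForm-split (2 ℕ.+ n)) (closedForm-split (1 ℕ.+ n)))
                            (closedForm-split n)) ⟩
        Φ closedForm n ∎
        where open ≡-Reasoning

  private
    sumTo-cong : ∀ n {f g : ℕ → ℤ} → (∀ i → i ≤ n → f i ≡ g i) → sumTo n f ≡ sumTo n g
    sumTo-cong zero    e = e 0 z≤n
    sumTo-cong (suc n) e =
      cong₂ _+_ (sumTo-cong n (λ i i≤n → e i (ℕ.m≤n⇒m≤1+n i≤n))) (e (suc n) ℕ.≤-refl)

    sumTo-zero : ∀ n → sumTo n (λ _ → + 0) ≡ + 0
    sumTo-zero zero    = refl
    sumTo-zero (suc n) = trans (+-identityʳ _) (sumTo-zero n)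

  ⋆-oneMinusX : ∀ g n → (g ⋆ oneMinusX) (suc n) ≡ g (suc n) - g n
  ⋆-oneMinusX g zero    = regroup (g 0) (g 1)
    where regroup : ∀ x y → x * - + 1 + y * + 1 ≡ y - x
          regroup = solve-∀
  ⋆-oneMinusX g (suc n) = begin
    sumTo n (λ i → g i * oneMinusX (2 ℕ.+ n ℕ.∸ i)) + g (suc n) * oneMinusX (2 ℕ.+ n ℕ.∸ suc n)
      + g (2 ℕ.+ n) * oneMinusX (2 ℕ.+ n ℕ.∸ (2 ℕ.+ n))
      ≡⟨ cong₂ (λ s t → s + g (suc n) * oneMinusX t + g (2 ℕ.+ n) * oneMinusX (2 ℕ.+ n ℕ.∸ (2 ℕ.+ n)))
               (trans (sumTo-cong n λ i i≤n → trans (cong (λ t → g i * oneMinusX t) (ℕ.+-∸-assoc 2 i≤n))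
                                                     (times-zero (g i)))
                      (sumTo-zero n))
               (ℕ.m+n∸n≡m 1 (suc n)) ⟩
    + 0 + g (suc n) * oneMinusX 1 + g (2 ℕ.+ n) * oneMinusX (2 ℕ.+ n ℕ.∸ (2 ℕ.+ n))
      ≡⟨ cong (λ t → + 0 + g (suc n) * - + 1 + g (2 ℕ.+ n) * oneMinusX t) (ℕ.n∸n≡0 (2 ℕ.+ n)) ⟩
    + 0 + g (suc n) * - + 1 + g (2 ℕ.+ n) * + 1
      ≡⟨ regroup (g (suc n)) (g (2 ℕ.+ n)) ⟩
    g (2 ℕ.+ n) - g (suc n) ∎
    where
      open ≡-Reasoning
      times-zero : ∀ x → x * + 0 ≡ + 0
      times-zero = solve-∀
      regroup : ∀ x y → + 0 + x * - + 1 + y * + 1 ≡ y - x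
      regroup = solve-∀

  ⋆-oneMinusX-vanishes : ∀ {g} L → (∀ j → g (L ℕ.+ j) ≡ + 0) →
                         ∀ j → (g ⋆ oneMinusX) (suc L ℕ.+ j) ≡ + 0
  ⋆-oneMinusX-vanishes {g} L z j = begin
    (g ⋆ oneMinusX) (suc (L ℕ.+ j))   ≡⟨ ⋆-oneMinusX g (L ℕ.+ j) ⟩
    g (suc (L ℕ.+ j)) - g (L ℕ.+ j)   ≡⟨ cong₂ _-_ (trans (cong g (sym (ℕ.+-suc L j))) (z (suc j))) (z j) ⟩
    + 0 - + 0                         ∎
    where open ≡-Reasoning

  denominator-vanishes : ∀ j → denominator (7 ℕ.+ j) ≡ + 0
  denominator-vanishes =
    ⋆-oneMinusX-vanishes {P ⋆ oneMinusX ⋆ oneMinusX ⋆ oneMinusX} 6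
      (⋆-oneMinusX-vanishes {P ⋆ oneMinusX ⋆ oneMinusX} 5
        (⋆-oneMinusX-vanishes {P ⋆ oneMinusX} 4
          (⋆-oneMinusX-vanishes {P} 3 λ _ → refl)))
    where P = poly (- + 1 ∷ + 1 ∷ + 1 ∷ [])

  private
    sumTo-truncate : ∀ {g : ℕ → ℤ} → (∀ i → g (7 ℕ.+ i) ≡ + 0) →
                     ∀ m → sumTo (6 ℕ.+ m) g ≡ sumTo 6 g
    sumTo-truncate z zero    = refl
    sumTo-truncate z (suc m) = trans (cong₂ _+_ (sumTo-truncate z m) (z m)) (+-identityʳ _)

  fourth-difference : ∀ {g} → DegreeBelow 4 g → ∀ n → Δ (Δ (Δ (Δ g))) n ≡ + 0
  fourth-difference (difference (difference (difference (difference (vanishing p))))) = p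

  denominator⋆ : ∀ f k → (denominator ⋆ f) (6 ℕ.+ k) ≡ - Δ (Δ (Δ (Δ (Φ f)))) k
  denominator⋆ f k =
    trans (sumTo-truncate (λ i → cong (_* f (6 ℕ.+ k ℕ.∸ (7 ℕ.+ i))) (denominator-vanishes i)) k)
    (expand (f k) (f (1 ℕ.+ k)) (f (2 ℕ.+ k)) (f (3 ℕ.+ k)) (f (4 ℕ.+ k)) (f (5 ℕ.+ k)) (f (6 ℕ.+ k)))
    where
      expand : ∀ x₀ x₁ x₂ x₃ x₄ x₅ x₆ →
        - + 1 * x₆ + + 5 * x₅ + - + 9 * x₄ + + 6 * x₃ + + 1 * x₂ + - + 3 * x₁ + + 1 * x₀ ≡
        (let d = λ a b → b - a
             φ₀ = x₂ - x₁ - x₀ ; φ₁ = x₃ - x₂ - x₁ ; φ₂ = x₄ - x₃ - x₂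
             φ₃ = x₅ - x₄ - x₃ ; φ₄ = x₆ - x₅ - x₄
             a₀ = d φ₀ φ₁ ; a₁ = d φ₁ φ₂ ; a₂ = d φ₂ φ₃ ; a₃ = d φ₃ φ₄
             b₀ = d a₀ a₁ ; b₁ = d a₁ a₂ ; b₂ = d a₂ a₃
         in - d (d b₀ b₁) (d b₁ b₂))
      expand = solve-∀

  sum≡⇒difference≡ : ∀ {a p q r s t} → a ℕ.+ p ℕ.+ q ℕ.+ r ℕ.+ s ≡ t →
                     + a ≡ + t - + p - + q - + r - + s
  sum≡⇒difference≡ {a} {p} {q} {r} {s} {t} refl = begin
    + a                                                     ≡⟨ cancel (+ a) (+ p) (+ q) (+ r) (+ s) ⟩
    + a + + p + + q + + r + + s - + p - + q - + r - + s       ≡⟨ cong (λ z → z - + p - + q - + r - + s) (sym pos-sum) ⟩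
    + (a ℕ.+ p ℕ.+ q ℕ.+ r ℕ.+ s) - + p - + q - + r - + s    ∎
    where
      open ≡-Reasoning
      cancel : ∀ a p q r s → a ≡ a + p + q + r + s - p - q - r - s
      cancel = solve-∀
      pos-sum : + (a ℕ.+ p ℕ.+ q ℕ.+ r ℕ.+ s) ≡ + a + + p + + q + + r + + s
      pos-sum = trans (pos-+ (a ℕ.+ p ℕ.+ q ℕ.+ r) s) (cong (_+ + s)
               (trans (pos-+ (a ℕ.+ p ℕ.+ q) r) (cong (_+ + r)
               (trans (pos-+ (a ℕ.+ p) q) (cong (_+ + q) (pos-+ a p))))))

open GeneratingFunction

open import Data.Nat using (_+_; _*_; _∸_)
open import Data.Nat.Properties
open import Data.Nat.Tactic.RingSolver using (solve-∀)

map-⊆⁻ : ∀ {A B : Set} (f : A → B) {xs ys} → ys ⊆ map f xs →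
         ∃ λ zs → zs ⊆ xs × map f zs ≡ ys
map-⊆⁻ f {[]}     []          = [] , [] , refl
map-⊆⁻ f {x ∷ xs} (_ ∷ʳ τ)    with zs , ρ , refl ← map-⊆⁻ f τ = zs , x ∷ʳ ρ , refl
map-⊆⁻ f {x ∷ xs} (refl ∷ τ)  with zs , ρ , refl ← map-⊆⁻ f τ = x ∷ zs , refl ∷ ρ , refl

⊆-++⁻ : ∀ {A : Set} (xs : List A) {ys zs} → zs ⊆ xs ++ ys →
        ∃₂ λ zs₁ zs₂ → zs ≡ zs₁ ++ zs₂ × zs₁ ⊆ xs × zs₂ ⊆ ys
⊆-++⁻ []       τ           = [] , _ , refl , [] , τ
⊆-++⁻ (x ∷ xs) (_ ∷ʳ τ)   with zs₁ , zs₂ , refl , τ₁ , τ₂ ← ⊆-++⁻ xs τ =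
  zs₁ , zs₂ , refl , x ∷ʳ τ₁ , τ₂
⊆-++⁻ (x ∷ xs) (refl ∷ τ) with zs₁ , zs₂ , refl , τ₁ , τ₂ ← ⊆-++⁻ xs τ =
  x ∷ zs₁ , zs₂ , refl , refl ∷ τ₁ , τ₂

map-≡-++⁻ : ∀ {A B : Set} (f : A → B) (ps : List A) {ys zs} → map f ps ≡ ys ++ zs →
            ∃₂ λ ps₁ ps₂ → ps ≡ ps₁ ++ ps₂ × map f ps₁ ≡ ys × map f ps₂ ≡ zs
map-≡-++⁻ f ps       {[]}     eq = [] , ps , refl , refl , eq
map-≡-++⁻ f (p ∷ ps) {y ∷ ys} eq
  with ps₁ , ps₂ , refl , eq₁ , eq₂ ← map-≡-++⁻ f ps {ys} (∷-injectiveʳ eq)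
  = p ∷ ps₁ , ps₂ , refl , cong₂ _∷_ (∷-injectiveˡ eq) eq₁ , eq₂

AllPairs-⊆ : ∀ {A : Set} {R : A → A → Set} {xs ys} → xs ⊆ ys → AllPairs R ys → AllPairs R xs
AllPairs-⊆ []         rs       = rs
AllPairs-⊆ (_ ∷ʳ τ)   (_ ∷ rs) = AllPairs-⊆ τ rs
AllPairs-⊆ (refl ∷ τ) (r ∷ rs) = Sublist.All-resp-⊆ τ r ∷ AllPairs-⊆ τ rs

AllPairs-++⁻ : ∀ {A : Set} {R : A → A → Set} xs {ys} → AllPairs R (xs ++ ys) →
               AllPairs R xs × AllPairs R ys × All (λ x → All (R x) ys) xs
AllPairs-++⁻ []       rs       = [] , rs , []
AllPairs-++⁻ (x ∷ xs) (r ∷ rs) with ra , rb , rab ← AllPairs-++⁻ xs rs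
  = proj₁ (All.++⁻ xs r) ∷ ra , rb , proj₂ (All.++⁻ xs r) ∷ rab

-- Pattern containment

SameOrder : ℕ × ℕ → ℕ × ℕ → Set
SameOrder (x , a) (y , b) = (x < y ⇔ a < b) × (y < x ⇔ b < a)

<-sameOrder : ∀ {x y a b} → x < y → a < b → SameOrder (x , a) (y , b)
<-sameOrder x<y a<b = mk⇔ (λ _ → a<b) (λ _ → x<y) ,
                      mk⇔ (λ y<x → ⊥-elim (<-asym x<y y<x)) (λ b<a → ⊥-elim (<-asym a<b b<a))

>-sameOrder : ∀ {x y a b} → x > y → a > b → SameOrder (x , a) (y , b)
>-sameOrder y<x b<a = mk⇔ (λ x<y → ⊥-elim (<-asym x<y y<x)) (λ a<b → ⊥-elim (<-asym a<b b<a)) ,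
                      mk⇔ (λ _ → b<a) (λ _ → y<x)

sameOrder-< : ∀ {p q} → SameOrder p q → proj₁ p < proj₁ q → proj₂ p < proj₂ q
sameOrder-< s = Equivalence.to (proj₁ s)

sameOrder-> : ∀ {p q} → SameOrder p q → proj₁ p > proj₁ q → proj₂ p > proj₂ q
sameOrder-> s = Equivalence.to (proj₂ s)

-- An occurrence of σ in π pairs a subsequence of π with σ, entry by entry.
infix 4 _≼_
record _≼_ (σ π : List ℕ) : Set where
  constructor occurrence
  field
    pairs     : List (ℕ × ℕ)
    inText    : map proj₁ pairs ⊆ π
    isPattern : map proj₂ pairs ≡ σ
    sameOrder : AllPairs SameOrder pairs

≼-⊆-trans : ∀ {σ π π′} → σ ≼ π → π ⊆ π′ → σ ≼ π′
≼-⊆-trans (occurrence ps τ eq s) ρ = occurrence ps (⊆-trans τ ρ) eq s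

⊆-≼-trans : ∀ {σ′ σ π} → σ′ ⊆ σ → σ ≼ π → σ′ ≼ π
⊆-≼-trans ρ (occurrence ps τ refl s) with qs , ρ′ , refl ← map-⊆⁻ proj₂ ρ =
  occurrence qs (⊆-trans (Sublist.map⁺ proj₁ ρ′) τ) refl (AllPairs-⊆ ρ′ s)

[]≼ : ∀ π → [] ≼ π
[]≼ π = occurrence [] (minimum π) refl []

≼-length : ∀ {σ π} → σ ≼ π → length σ ≤ length π
≼-length (occurrence ps τ refl _) rewrite length-map proj₂ ps | sym (length-map proj₁ ps) =
  Sublist.length-mono-≤ τ

¬≼[] : ∀ {x σ} → ¬ x ∷ σ ≼ []
¬≼[] o with () ← ≼-length o

≼-singleton : ∀ {x π} c → x ∈ π → [ c ] ≼ π
≼-singleton {x} c x∈π = occurrence [ x , c ] (from∈ x∈π) refl ([] ∷ [])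

pair≼ : ∀ {x y xs} a b → SameOrder (x , a) (y , b) → y ∈ xs → a ∷ b ∷ [] ≼ x ∷ xs
pair≼ a b s y∈xs = occurrence _ (refl ∷ from∈ y∈xs) refl ((s ∷ []) ∷ [] ∷ [])

Decreasing Increasing : List ℕ → Set
Decreasing = AllPairs _>_
Increasing = AllPairs _<_

module _ {R : ℕ → ℕ → Set}
         (preserve : ∀ {p q} → SameOrder p q → R (proj₁ p) (proj₁ q) → R (proj₂ p) (proj₂ q))
         where

  ≼-AllPairs : ∀ {σ π} → AllPairs R π → σ ≼ π → AllPairs R σ
  ≼-AllPairs r (occurrence ps τ refl s) =
    AllPairs.map⁺ (AllPairs.zipWith (λ (r , s) → preserve s r) (AllPairs.map⁻ (AllPairs-⊆ τ r) , s))

≼-decreasing : ∀ {σ π} → Decreasing π → σ ≼ π → Decreasing σ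
≼-decreasing = ≼-AllPairs sameOrder->

≼-increasing : ∀ {σ π} → Increasing π → σ ≼ π → Increasing σ
≼-increasing = ≼-AllPairs sameOrder-<

module SeparatedSum {R : ℕ → ℕ → Set}
           (preserve : ∀ {p q} → SameOrder p q → R (proj₁ p) (proj₁ q) → R (proj₂ p) (proj₂ q))
           (reflect : ∀ {x y a b} → R x y → R a b → SameOrder (x , a) (y , b))
           where

  Separated : List ℕ → List ℕ → Set
  Separated xs ys = All (λ x → All (R x) ys) xs

  separated-⊆ : ∀ {xs xs′ ys ys′} → xs′ ⊆ xs → ys′ ⊆ ys → Separated xs ys → Separated xs′ ys′
  separated-⊆ τ ρ sep = All.map (Sublist.All-resp-⊆ ρ) (Sublist.All-resp-⊆ τ sep)

  private
    Cross : List (ℕ × ℕ) → List (ℕ × ℕ) → Set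
    Cross ps qs = All (λ p → All (SameOrder p) qs) ps

    cross-preserve : ∀ ps qs → Cross ps qs →
                     Separated (map proj₁ ps) (map proj₁ qs) → Separated (map proj₂ ps) (map proj₂ qs)
    cross-preserve ps qs c sep = All.map⁺ (All.zipWith
      (λ (c , r) → All.map⁺ (All.zipWith (λ (s , r) → preserve s r) (c , All.map⁻ r)))
      (c , All.map⁻ sep))

    cross-reflect : ∀ ps qs → Separated (map proj₁ ps) (map proj₁ qs) →
                    Separated (map proj₂ ps) (map proj₂ qs) → Cross ps qs
    cross-reflect ps qs sep₁ sep₂ = All.zipWith
      (λ (r₁ , r₂) → All.zipWith (λ (r₁ , r₂) → reflect r₁ r₂) (All.map⁻ r₁ , All.map⁻ r₂))
      (All.map⁻ sep₁ , All.map⁻ sep₂)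

  split : ∀ {α β σ} → Separated α β → σ ≼ α ++ β →
          ∃₂ λ σ₁ σ₂ → σ₁ ++ σ₂ ≡ σ × σ₁ ≼ α × σ₂ ≼ β × Separated σ₁ σ₂
  split {α} sep (occurrence ps τ refl s)
    with zs₁ , zs₂ , eq , τ₁ , τ₂ ← ⊆-++⁻ α τ
    with ps₁ , ps₂ , refl , refl , refl ← map-≡-++⁻ proj₁ ps {zs₁} {zs₂} eq
    with s₁ , s₂ , c ← AllPairs-++⁻ ps₁ s
    = map proj₂ ps₁ , map proj₂ ps₂ , sym (map-++ proj₂ ps₁ ps₂) ,
      occurrence ps₁ τ₁ refl s₁ , occurrence ps₂ τ₂ refl s₂ ,
      cross-preserve ps₁ ps₂ c (separated-⊆ τ₁ τ₂ sep)

  join : ∀ {α β σ₁ σ₂} → Separated α β → σ₁ ≼ α → σ₂ ≼ β → Separated σ₁ σ₂ →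
         σ₁ ++ σ₂ ≼ α ++ β
  join sep (occurrence ps₁ τ₁ refl s₁) (occurrence ps₂ τ₂ refl s₂) sep′ =
    occurrence (ps₁ ++ ps₂)
      (subst (_⊆ _) (sym (map-++ proj₁ ps₁ ps₂)) (Sublist.++⁺ τ₁ τ₂))
      (map-++ proj₂ ps₁ ps₂)
      (AllPairs.++⁺ s₁ s₂ (cross-reflect ps₁ ps₂ (separated-⊆ τ₁ τ₂ sep) sep′))

-- α ++ β is the skew sum of α and β when α lies above β, and their direct sum when below.
open SeparatedSum {_>_} sameOrder-> >-sameOrder
  using () renaming (Separated to Above; split to skew-split; join to skew-join)
open SeparatedSum {_<_} sameOrder-< <-sameOrder
  using () renaming (Separated to Below; split to direct-split; join to direct-join)

-- The splittings of a concrete pattern admissible in a sum are computed, so that a case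
-- analysis over them is a finite match on membership in the computed list.
splits : List ℕ → List (List ℕ × List ℕ)
splits []       = [ [] , [] ]
splits (x ∷ xs) = ([] , x ∷ xs) ∷ map (Product.map₁ (x ∷_)) (splits xs)

∈-splits : ∀ σ₁ {σ₂ σ} → σ₁ ++ σ₂ ≡ σ → (σ₁ , σ₂) ∈ splits σ
∈-splits []        {[]}    refl = here refl
∈-splits []        {_ ∷ _} refl = here refl
∈-splits (x ∷ σ₁)          refl = there (∈-map⁺ (Product.map₁ (x ∷_)) (∈-splits σ₁ refl))

module _ {P : List ℕ → List ℕ → Set} (P? : ∀ σ₁ σ₂ → Dec (P σ₁ σ₂)) where

  splitsBy : List ℕ → List (List ℕ × List ℕ)
  splitsBy σ = filter (λ s → P? (proj₁ s) (proj₂ s)) (splits σ)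

  ∈-splitsBy : ∀ {σ₁ σ₂ σ} → σ₁ ++ σ₂ ≡ σ → P σ₁ σ₂ → (σ₁ , σ₂) ∈ splitsBy σ
  ∈-splitsBy {σ₁} eq p = ∈-filter⁺ (λ s → P? (proj₁ s) (proj₂ s)) (∈-splits σ₁ eq) p

above? : ∀ xs ys → Dec (Above xs ys)
above? xs ys = All.all? (λ x → All.all? (x >?_) ys) xs

below? : ∀ xs ys → Dec (Below xs ys)
below? xs ys = All.all? (λ x → All.all? (x <?_) ys) xs

above! : ∀ {xs ys} {_ : True (above? xs ys)} → Above xs ys
above! {xs} {ys} {t} = toWitness t

below! : ∀ {xs ys} {_ : True (below? xs ys)} → Below xs ys
below! {xs} {ys} {t} = toWitness t

decreasing? : ∀ xs → Dec (Decreasing xs)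
decreasing? = AllPairs.allPairs? (λ x y → y <? x)

¬decreasing! : ∀ {xs} {_ : False (decreasing? xs)} → ¬ Decreasing xs
¬decreasing! {xs} {f} = toWitnessFalse f

increasing? : ∀ xs → Dec (Increasing xs)
increasing? = AllPairs.allPairs? _<?_

MaxSplit : List ℕ → List ℕ → Set
MaxSplit σ₁ τ = Below σ₁ τ × length τ ≤ 1

maxSplit? : ∀ σ₁ τ → Dec (MaxSplit σ₁ τ)
maxSplit? σ₁ τ = below? σ₁ τ ×-dec (length τ ≤? 1)

skewSplits maxSplits : List ℕ → List (List ℕ × List ℕ)
skewSplits = splitsBy above?
maxSplits  = splitsBy maxSplit?

private
  below-max : ∀ {α m} → All (_< m) α → Below α [ m ]
  below-max = All.map (_∷ [])

  above-max : ∀ {α β m} → Above α β → All (_< m) β → Above (α ++ [ m ]) β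
  above-max α>β β<m = All.++⁺ α>β (β<m ∷ [])

  reassoc : ∀ (α : List ℕ) {m β} → (α ++ [ m ]) ++ β ≡ α ++ m ∷ β
  reassoc α = ++-assoc α _ _

max-split : ∀ {α m σ} → All (_< m) α → σ ≼ α ++ [ m ] →
            ∃₂ λ σ₁ τ → (σ₁ , τ) ∈ maxSplits σ × σ₁ ≼ α
max-split α<m o with σ₁ , τ , eq , o₁ , o₂ , below ← direct-split (below-max α<m) o =
  σ₁ , τ , ∈-splitsBy maxSplit? eq (below , ≼-length o₂) , o₁

max-join : ∀ {α m σ τ} → All (_< m) α → σ ≼ α → τ ≼ [ m ] → Below σ τ → σ ++ τ ≼ α ++ [ m ]
max-join α<m = direct-join (below-max α<m)

top-split : ∀ {α β m σ} → Above α β → All (_< m) α → All (_< m) β → σ ≼ α ++ m ∷ β →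
            ∃₂ λ σ₁ σ₂ → (σ₁ , σ₂) ∈ skewSplits σ × σ₁ ≼ α ++ [ m ] × σ₂ ≼ β
top-split {α} α>β α<m β<m o
  with σ₁ , σ₂ , eq , o₁ , o₂ , above ← skew-split (above-max α>β β<m) (subst (_ ≼_) (sym (reassoc α)) o) =
  σ₁ , σ₂ , ∈-splitsBy above? eq above , o₁ , o₂

top-join : ∀ {α β m σ₁ τ σ₂} → Above α β → All (_< m) α → All (_< m) β →
           σ₁ ≼ α → τ ≼ [ m ] → σ₂ ≼ β → Below σ₁ τ → Above (σ₁ ++ τ) σ₂ →
           σ₁ ++ τ ++ σ₂ ≼ α ++ m ∷ β
top-join {α} {σ₁ = σ₁} α>β α<m β<m o₁ oτ o₂ below above =
  subst₂ _≼_ (++-assoc σ₁ _ _) (reassoc α)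
    (skew-join (above-max α>β β<m) (max-join α<m o₁ oτ below) o₂ above)

private
  remove : ∀ {A : Set} {x : A} (ys : List A) → x ∈ ys → List A
  remove (_ ∷ ys) (here _)  = ys
  remove (y ∷ ys) (there p) = y ∷ remove ys p

  length-remove : ∀ {A : Set} {x : A} ys (p : x ∈ ys) → suc (length (remove ys p)) ≡ length ys
  length-remove (_ ∷ _)  (here _)  = refl
  length-remove (_ ∷ ys) (there p) = cong suc (length-remove ys p)

  ∈-remove : ∀ {A : Set} {x z : A} ys (p : x ∈ ys) → z ∈ ys → z ≢ x → z ∈ remove ys p
  ∈-remove (_ ∷ _)  (here refl) (here refl) z≢x = ⊥-elim (z≢x refl)
  ∈-remove (_ ∷ _)  (here refl) (there q)   _   = q
  ∈-remove (_ ∷ _)  (there p)   (here e)    _   = here e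
  ∈-remove (_ ∷ ys) (there p)   (there q)   z≢x = there (∈-remove ys p q z≢x)

unique-length-≤ : ∀ {A : Set} {xs ys : List A} → Unique xs → (∀ {z} → z ∈ xs → z ∈ ys) →
                  length xs ≤ length ys
unique-length-≤ {xs = []}          []         _   = z≤n
unique-length-≤ {xs = x ∷ xs} {ys} (x∉ ∷ uxs) sub = subst (suc (length xs) ≤_) (length-remove ys p)
  (s≤s (unique-length-≤ uxs λ q → ∈-remove ys p (sub (there q)) λ { refl → All.lookup x∉ q refl }))
  where p = sub (here refl)

-- Permutations as lists

record IsPermutation (n : ℕ) (π : List ℕ) : Set where
  constructor isPermutation
  field
    unique  : Unique π
    bounded : All (_< n) π
    size    : length π ≡ n

open IsPermutation

perm-∈ : ∀ {n π v} → IsPermutation n π → v < n → v ∈ π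
perm-∈ {n} {π} {v} p v<n with v ∈? π
... | yes v∈π = v∈π
... | no  v∉π = ⊥-elim (<-irrefl (size p) (≤-trans
      (unique-length-≤ (All.tabulate (λ q v≡ → v∉π (subst (_∈ π) (sym v≡) q)) ∷ unique p)
        λ { (here refl) → ∈-upTo⁺ v<n ; (there q) → ∈-upTo⁺ (All.lookup (bounded p) q) })
      (≤-reflexive (length-upTo n))))

-- run k lo = [k + lo - 1, …, lo + 1, lo]
run : ℕ → ℕ → List ℕ
run k lo = applyDownFrom (_+ lo) k

length-run : ∀ k lo → length (run k lo) ≡ k
length-run k lo = length-applyDownFrom (_+ lo) k

run-bounds : ∀ k lo → All (λ v → lo ≤ v × v < k + lo) (run k lo)
run-bounds k lo = All.tabulate λ q → bounds (∈-applyDownFrom⁻ (_+ lo) q)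
  where bounds : ∀ {v} → ∃ (λ i → i < k × v ≡ i + lo) → lo ≤ v × v < k + lo
        bounds (i , i<k , refl) = m≤n+m lo i , +-monoˡ-< lo i<k

run-decreasing : ∀ k lo → Decreasing (run k lo)
run-decreasing k lo = AllPairs.applyDownFrom⁺₁ (_+ lo) k (λ j<i _ → +-monoˡ-< lo j<i)

decreasing-unique : ∀ {xs} → Decreasing xs → Unique xs
decreasing-unique = AllPairs.map (λ { x>y refl → <-irrefl refl x>y })

run-descent : ∀ {k a b} lo → 2 ≤ k → a > b → a ∷ b ∷ [] ≼ run k lo
run-descent {suc zero}    lo (s≤s ()) _
run-descent {suc (suc k)} lo _ a>b = pair≼ _ _ (>-sameOrder (n<1+n (k + lo)) a>b) (here refl)

private
  decreasing-length : ∀ {lo x} ys → Decreasing ys → All (lo ≤_) ys → All (_< x) ys → lo ≤ x →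
                      length ys + lo ≤ x
  decreasing-length []       _        _          _          lo≤x = lo≤x
  decreasing-length (y ∷ ys) (y> ∷ d) (lo≤y ∷ l) (y<x ∷ u) _   =
    ≤-trans (s≤s (decreasing-length ys d l y> lo≤y)) y<x

decreasing-run : ∀ k lo xs → Decreasing xs → All (lo ≤_) xs → All (_< k + lo) xs → length xs ≡ k →
                 xs ≡ run k lo
decreasing-run zero    lo []       _        _          _         _    = refl
decreasing-run (suc k) lo (x ∷ xs) (x> ∷ d) (lo≤x ∷ l) (x< ∷ u) refl =
  cong₂ _∷_ x≡ (decreasing-run k lo xs d l (subst (λ v → All (_< v) xs) x≡ x>) refl)
  where x≡ : x ≡ k + lo
        x≡ = ≤-antisym (≤-pred x<) (decreasing-length xs d l x> lo≤x)

private
  increasing-length : ∀ {x h} ys → Increasing ys → All (x <_) ys → All (_< h) ys → x < h → x + length ys < h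
  increasing-length {x} []       _        _          _         x<h = subst (_< _) (sym (+-identityʳ x)) x<h
  increasing-length {x} {h} (y ∷ ys) (y< ∷ i) (x<y ∷ l) (y<h ∷ u) _   =
    subst (_< h) (sym (+-suc x (length ys)))
      (≤-trans (s≤s (+-monoˡ-≤ (length ys) x<y)) (increasing-length ys i y< u y<h))

  applyUpTo-cong : ∀ {f g : ℕ → ℕ} → (∀ i → f i ≡ g i) → ∀ k → applyUpTo f k ≡ applyUpTo g k
  applyUpTo-cong e zero    = refl
  applyUpTo-cong e (suc k) = cong₂ _∷_ (e 0) (applyUpTo-cong (λ i → e (suc i)) k)

increasing-applyUpTo : ∀ k lo xs → Increasing xs → All (lo ≤_) xs → All (_< k + lo) xs → length xs ≡ k →
                       xs ≡ applyUpTo (_+_ lo) k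
increasing-applyUpTo zero    lo []       _        _          _         _    = refl
increasing-applyUpTo (suc k) lo (x ∷ xs) (x< ∷ i) (lo≤x ∷ l) (x<h ∷ u) refl =
  cong₂ _∷_ (trans x≡ (sym (+-identityʳ lo)))
    (trans (increasing-applyUpTo k (suc lo) xs i (subst (λ v → All (v <_) xs) x≡ x<)
                                 (subst (λ v → All (_< v) xs) (sym (+-suc k lo)) u) refl)
           (applyUpTo-cong (λ j → sym (+-suc lo j)) k))
  where x≡ : x ≡ lo
        x≡ = ≤-antisym (+-cancelʳ-≤ k x lo (≤-pred (subst (x + k <_) (cong suc (+-comm k lo))
               (increasing-length xs i x< u x<h)))) lo≤x

p132 p213 p2341 p4213 p54213 : List ℕ
p132   = 0 ∷ 2 ∷ 1 ∷ []
p213   = 1 ∷ 0 ∷ 2 ∷ []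
p2341  = 1 ∷ 2 ∷ 3 ∷ 0 ∷ []
p4213  = 3 ∷ 1 ∷ 0 ∷ 2 ∷ []
p54213 = 4 ∷ 3 ∷ 1 ∷ 0 ∷ 2 ∷ []

avoids-ascent⇒decreasing : ∀ {a b xs} → a < b → Unique xs → ¬ a ∷ b ∷ [] ≼ xs → Decreasing xs
avoids-ascent⇒decreasing {xs = []}     _   []         _    = []
avoids-ascent⇒decreasing {xs = x ∷ xs} a<b (x∉ ∷ uxs) ¬asc =
  All.tabulate (λ {y} y∈ → ≤∧≢⇒< (≮⇒≥ λ x<y → ¬asc (pair≼ _ _ (<-sameOrder x<y a<b) y∈))
                                  (λ { refl → All.lookup x∉ y∈ refl }))
  ∷ avoids-ascent⇒decreasing a<b uxs (λ o → ¬asc (≼-⊆-trans o (x ∷ʳ ⊆-refl)))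

avoids-descent⇒increasing : ∀ {a b xs} → a > b → Unique xs → ¬ a ∷ b ∷ [] ≼ xs → Increasing xs
avoids-descent⇒increasing {xs = []}     _   []         _     = []
avoids-descent⇒increasing {xs = x ∷ xs} a>b (x∉ ∷ uxs) ¬desc =
  All.tabulate (λ {y} y∈ → ≤∧≢⇒< (≮⇒≥ λ y<x → ¬desc (pair≼ _ _ (>-sameOrder y<x a>b) y∈))
                                  (λ { refl → All.lookup x∉ y∈ refl }))
  ∷ avoids-descent⇒increasing a>b uxs (λ o → ¬desc (≼-⊆-trans o (x ∷ʳ ⊆-refl)))

-- Structure of 132-avoiders

module _ {m α β} (p : IsPermutation (suc m) (α ++ m ∷ β)) where

  private
    <max : ∀ {v} → v < suc m → v ≢ m → v < m
    <max v≤m v≢m = ≤∧≢⇒< (≤-pred v≤m) v≢m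

    parts = AllPairs-++⁻ α (unique p)

  left-unique : Unique α
  left-unique = proj₁ parts

  left<max : All (_< m) α
  left<max = All.zipWith (λ (v< , v∉) → <max v< (All.head v∉))
                         (proj₁ (All.++⁻ α (bounded p)) , proj₂ (proj₂ parts))

  right<max : All (_< m) β
  right<max with m∉β ∷ _ ← proj₁ (proj₂ parts) =
    All.zipWith (λ (v< , m≢v) → <max v< (λ v≡m → m≢v (sym v≡m)))
                (All.tail (proj₂ (All.++⁻ α (bounded p))) , m∉β)

  left∉right : ∀ {a b} → a ∈ α → b ∈ β → a ≢ b
  left∉right a∈ b∈ = All.lookup (All.tail (All.lookup (proj₂ (proj₂ parts)) a∈)) b∈

  sizes : length α + length β ≡ m
  sizes = suc-injective (trans (sym (+-suc (length α) (length β))) (trans (sym (length-++ α)) (size p)))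

  left>right : ¬ p132 ≼ α ++ m ∷ β → Above α β
  left>right ¬132 = All.tabulate λ {a} a∈ → All.tabulate λ {b} b∈ →
    ≤∧≢⇒< (≮⇒≥ λ a<b → ¬132 (occurrence ((a , 0) ∷ (m , 2) ∷ (b , 1) ∷ [])
                                (Sublist.++⁺ (from∈ a∈) (refl ∷ from∈ b∈)) refl
                                ((<-sameOrder (All.lookup left<max a∈) (s≤s z≤n) ∷
                                  <-sameOrder a<b (s≤s z≤n) ∷ [])
                                 ∷ (>-sameOrder (All.lookup right<max b∈) (s≤s (s≤s z≤n)) ∷ []) ∷ [] ∷ [])))
          (λ b≡a → left∉right a∈ b∈ (sym b≡a))

  module _ (α>β : Above α β) where

    private
      right-downClosed : ∀ {b v} → b ∈ β → v ≤ b → v ∈ β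
      right-downClosed b∈ v≤b
        with ∈-++⁻ α (perm-∈ p (s≤s (≤-trans v≤b (<⇒≤ (All.lookup right<max b∈)))))
      ... | inj₁ v∈α         = ⊥-elim (<-irrefl refl (≤-trans (s≤s v≤b) (All.lookup (All.lookup α>β v∈α) b∈)))
      ... | inj₂ (here refl) = ⊥-elim (<-irrefl refl (≤-trans (s≤s v≤b) (All.lookup right<max b∈)))
      ... | inj₂ (there v∈β) = v∈β

    right-perm : IsPermutation (length β) β
    right-perm with _ ∷ uβ ← proj₁ (proj₂ parts) = isPermutation uβ
      (All.tabulate λ {b} b∈ → subst (_≤ length β) (length-upTo (suc b))
        (unique-length-≤ (Unique.upTo⁺ (suc b)) λ v∈ → right-downClosed b∈ (≤-pred (∈-upTo⁻ v∈))))
      refl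

    left-bounds : All (λ a → length β ≤ a × a < m) α
    left-bounds = All.tabulate λ a∈ →
      ≮⇒≥ (λ a<|β| → left∉right a∈ (perm-∈ right-perm a<|β|) refl) , All.lookup left<max a∈

block : ℕ → ℕ → List ℕ → List ℕ
block m j β = run (m ∸ j) j ++ m ∷ β

data Shape (m : ℕ) : List ℕ → Set where
  max-last  : ∀ {α} → IsPermutation m α → Shape m (α ++ [ m ])
  run-max   : ∀ {j β} → 1 ≤ j → j ≤ m → IsPermutation j β → Shape m (block m j β)

shape : ∀ {m π} → IsPermutation (suc m) π → ¬ p132 ≼ π → ¬ p2341 ≼ π → Shape m π
shape {m} p ¬132 ¬2341 with ∈-∃++ (perm-∈ p (n<1+n m))
... | α , []          , refl = max-last (isPermutation (left-unique p) (left<max p)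
                                          (trans (sym (+-identityʳ (length α))) (sizes p)))
... | α , β@(_ ∷ _) , refl = subst (Shape m) (cong (_++ m ∷ β) (sym α≡run)) (run-max (s≤s z≤n) j≤m βp)
  where
    α>β = left>right p ¬132
    βp  = right-perm p α>β
    j   = length β

    j≤m : j ≤ m
    j≤m = subst (j ≤_) (sizes p) (m≤n+m j (length α))

    ¬12 : ¬ 1 ∷ 2 ∷ [] ≼ α
    ¬12 o = ¬2341 (top-join α>β (left<max p) (right<max p) o (≼-singleton 3 (here refl)) (≼-singleton 0 (here refl))
                            below! above!)

    α≡run : α ≡ run (m ∸ j) j
    α≡run = decreasing-run (m ∸ j) j α (avoids-ascent⇒decreasing (s≤s (s≤s z≤n)) (left-unique p) ¬12)
              (All.map proj₁ (left-bounds p α>β))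
              (All.map (λ (_ , a<m) → subst (_ <_) (sym (m∸n+n≡m j≤m)) a<m) (left-bounds p α>β))
              (trans (sym (m+n∸n≡m (length α) j)) (cong (_∸ j) (sizes p)))

private
  split-at-unique : ∀ {m : ℕ} xs ys {zs ws : List ℕ} → All (m ≢_) xs → All (m ≢_) ys →
                    xs ++ m ∷ zs ≡ ys ++ m ∷ ws → xs ≡ ys × zs ≡ ws
  split-at-unique []       []       _          _          eq = refl , ∷-injectiveʳ eq
  split-at-unique []       (_ ∷ _)  _          (m≢y ∷ _)  eq = ⊥-elim (m≢y (∷-injectiveˡ eq))
  split-at-unique (_ ∷ _)  []       (m≢x ∷ _)  _          eq = ⊥-elim (m≢x (sym (∷-injectiveˡ eq)))
  split-at-unique (_ ∷ xs) (_ ∷ ys) (_ ∷ m∉xs) (_ ∷ m∉ys) eq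
    with xs≡ , zs≡ ← split-at-unique xs ys m∉xs m∉ys (∷-injectiveʳ eq) =
    cong₂ _∷_ (∷-injectiveˡ eq) xs≡ , zs≡

  below-≢ : ∀ {m xs} → All (_< m) xs → All (m ≢_) xs
  below-≢ = All.map λ { v<m refl → <-irrefl refl v<m }

run-below : ∀ {j m} → j ≤ m → All (_< m) (run (m ∸ j) j)
run-below {j} {m} j≤m = All.map (λ (_ , v<) → subst (_ <_) (m∸n+n≡m j≤m) v<) (run-bounds (m ∸ j) j)

block-injective : ∀ {m j j′ β β′} → j ≤ m → j′ ≤ m → block m j β ≡ block m j′ β′ →
                  j ≡ j′ × β ≡ β′
block-injective {m} {j} {j′} {β} {β′} j≤m j′≤m eq =
  trans (sym (m∸[m∸n]≡n j≤m)) (trans (cong (m ∸_) gaps) (m∸[m∸n]≡n j′≤m)) , proj₂ parts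
  where
    parts : run (m ∸ j) j ≡ run (m ∸ j′) j′ × β ≡ β′
    parts = split-at-unique _ _ (below-≢ (run-below j≤m)) (below-≢ (run-below j′≤m)) eq
    gaps : m ∸ j ≡ m ∸ j′
    gaps = trans (sym (length-run (m ∸ j) j)) (trans (cong length (proj₁ parts)) (length-run (m ∸ j′) j′))

max-last≢block : ∀ {m j α β} → All (_< m) α → j ≤ m → β ≢ [] → α ++ [ m ] ≢ block m j β
max-last≢block α<m j≤m β≢[] eq =
  β≢[] (sym (proj₂ (split-at-unique _ _ (below-≢ α<m) (below-≢ (run-below j≤m)) eq)))

-- Lists of permutations of the two shapes

blocksUpTo : ℕ → (ℕ → List (List ℕ)) → ℕ → List (List ℕ)
blocksUpTo m F zero    = []
blocksUpTo m F (suc t) = blocksUpTo m F t ++ map (block m (suc t)) (F (suc t))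

extend : ℕ → List (List ℕ) → (ℕ → List (List ℕ)) → List (List ℕ)
extend m L F = map (_++ [ m ]) L ++ blocksUpTo m F m

∈-blocksUpTo⁻ : ∀ {m F π} t → π ∈ blocksUpTo m F t →
                ∃₂ λ j β → 1 ≤ j × j ≤ t × β ∈ F j × π ≡ block m j β
∈-blocksUpTo⁻ {m} {F} (suc t) π∈ with ∈-++⁻ (blocksUpTo m F t) π∈
... | inj₁ π∈′ with j , β , 1≤j , j≤t , β∈ , refl ← ∈-blocksUpTo⁻ t π∈′ =
  j , β , 1≤j , m≤n⇒m≤1+n j≤t , β∈ , refl
... | inj₂ π∈′ with β , β∈ , refl ← ∈-map⁻ (block m (suc t)) π∈′ =
  suc t , β , s≤s z≤n , ≤-refl , β∈ , refl

∈-blocksUpTo⁺ : ∀ {m F j β} t → 1 ≤ j → j ≤ t → β ∈ F j → block m j β ∈ blocksUpTo m F t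
∈-blocksUpTo⁺ zero (s≤s _) () _
∈-blocksUpTo⁺ {m} {F} {j} (suc t) 1≤j j≤t β∈ with m≤n⇒m<n∨m≡n j≤t
... | inj₁ j<t  = ∈-++⁺ˡ (∈-blocksUpTo⁺ t 1≤j (≤-pred j<t) β∈)
... | inj₂ refl = ∈-++⁺ʳ (blocksUpTo m F t) (∈-map⁺ (block m j) β∈)

∈-extend⁻ : ∀ m L F {π} → π ∈ extend m L F →
            (∃ λ α → α ∈ L × π ≡ α ++ [ m ]) ⊎
            (∃₂ λ j β → 1 ≤ j × j ≤ m × β ∈ F j × π ≡ block m j β)
∈-extend⁻ m L F π∈ with ∈-++⁻ (map (_++ [ m ]) L) π∈
... | inj₁ π∈′ = inj₁ (∈-map⁻ (_++ [ m ]) π∈′)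
... | inj₂ π∈′ = inj₂ (∈-blocksUpTo⁻ m π∈′)

∈-extend⁺ˡ : ∀ {m L F α} → α ∈ L → α ++ [ m ] ∈ extend m L F
∈-extend⁺ˡ {m} α∈ = ∈-++⁺ˡ (∈-map⁺ (_++ [ m ]) α∈)

∈-extend⁺ʳ : ∀ {m L F j β} → 1 ≤ j → j ≤ m → β ∈ F j → block m j β ∈ extend m L F
∈-extend⁺ʳ {m} {L} 1≤j j≤m β∈ = ∈-++⁺ʳ (map (_++ [ m ]) L) (∈-blocksUpTo⁺ m 1≤j j≤m β∈)

module _ {m : ℕ} {L : List (List ℕ)} {F : ℕ → List (List ℕ)}
         (L-perm : ∀ {α} → α ∈ L → IsPermutation m α)
         (F-perm : ∀ {j β} → j ≤ m → β ∈ F j → IsPermutation j β)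
         (L-unique : Unique L) (F-unique : ∀ j → Unique (F j))
         where

  private
    nonempty : ∀ {j β} → 1 ≤ j → j ≤ m → β ∈ F j → β ≢ []
    nonempty 1≤j j≤m β∈ refl = <-irrefl (size (F-perm j≤m β∈)) 1≤j

    blocksUpTo-unique : ∀ t → t ≤ m → Unique (blocksUpTo m F t)
    blocksUpTo-unique zero    _   = []
    blocksUpTo-unique (suc t) t<m = Unique.++⁺ (blocksUpTo-unique t (<⇒≤ t<m))
      (Unique.map⁺ (λ eq → proj₂ (block-injective t<m t<m eq)) (F-unique (suc t)))
      λ (π∈ , π∈′) → disjoint π∈ π∈′
      where
        disjoint : ∀ {π} → π ∈ blocksUpTo m F t → π ∈ map (block m (suc t)) (F (suc t)) → ⊥
        disjoint π∈ π∈′ with _ , _ , _ , j≤t , _ , refl ← ∈-blocksUpTo⁻ t π∈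
                           | _ , _ , eq ← ∈-map⁻ (block m (suc t)) π∈′ =
          <-irrefl (proj₁ (block-injective (≤-trans j≤t (<⇒≤ t<m)) t<m eq)) (s≤s j≤t)

  extend-unique : Unique (extend m L F)
  extend-unique = Unique.++⁺ (Unique.map⁺ (λ {α} {α′} → ∷ʳ-injectiveˡ α α′) L-unique)
                             (blocksUpTo-unique m ≤-refl)
                             λ (π∈ , π∈′) → disjoint π∈ π∈′
    where
      disjoint : ∀ {π} → π ∈ map (_++ [ m ]) L → π ∈ blocksUpTo m F m → ⊥
      disjoint π∈ π∈′ with α , α∈ , refl ← ∈-map⁻ (_++ [ m ]) π∈
                         | _ , _ , 1≤j , j≤m , β∈ , eq ← ∈-blocksUpTo⁻ m π∈′ =
        max-last≢block (bounded (L-perm α∈)) j≤m (nonempty 1≤j j≤m β∈) eq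

∑₁ : ℕ → (ℕ → ℕ) → ℕ
∑₁ zero    g = 0
∑₁ (suc t) g = ∑₁ t g + g (suc t)

length-extend : ∀ m L F → length (extend m L F) ≡ length L + ∑₁ m (λ j → length (F j))
length-extend m L F = trans (length-++ (map (_++ [ m ]) L)) (cong₂ _+_ (length-map _ L) (length-blocksUpTo m))
  where
    length-blocksUpTo : ∀ t → length (blocksUpTo m F t) ≡ ∑₁ t (λ j → length (F j))
    length-blocksUpTo zero    = refl
    length-blocksUpTo (suc t) = trans (length-++ (blocksUpTo m F t))
      (cong₂ _+_ (length-blocksUpTo t) (length-map (block m (suc t)) (F (suc t))))

module _ {m j β} (j≤m : j ≤ m) (β-perm : IsPermutation j β) where

  private
    run>β : Above (run (m ∸ j) j) β
    run>β = All.map (λ (j≤v , _) → All.map (λ b<j → <-≤-trans b<j j≤v) (bounded β-perm))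
                    (run-bounds (m ∸ j) j)

    β<m : All (_< m) β
    β<m = All.map (λ b<j → <-≤-trans b<j j≤m) (bounded β-perm)

  block-split : ∀ {σ} → σ ≼ block m j β →
                ∃₂ λ σ₁ σ₂ → (σ₁ , σ₂) ∈ skewSplits σ × σ₂ ≼ β ×
                ∃₂ λ τ₁ τ₂ → (τ₁ , τ₂) ∈ maxSplits σ₁ × Decreasing τ₁ × length τ₁ ≤ m ∸ j
  block-split o
    with σ₁ , σ₂ , σ∈ , o₁ , o₂ ← top-split run>β (run-below j≤m) β<m o
    with τ₁ , τ₂ , σ₁∈ , oτ ← max-split (run-below j≤m) o₁
    = σ₁ , σ₂ , σ∈ , o₂ , τ₁ , τ₂ , σ₁∈ , ≼-decreasing (run-decreasing (m ∸ j) j) oτ ,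
      subst (length τ₁ ≤_) (length-run (m ∸ j) j) (≼-length oτ)

  block-join : ∀ {σ₁ τ σ₂} → σ₁ ≼ run (m ∸ j) j → τ ≼ [ m ] → σ₂ ≼ β →
               Below σ₁ τ → Above (σ₁ ++ τ) σ₂ → σ₁ ++ τ ++ σ₂ ≼ block m j β
  block-join = top-join run>β (run-below j≤m) β<m

  block-avoids-132 : ¬ p132 ≼ β → ¬ p132 ≼ block m j β
  block-avoids-132 ¬132 o with block-split o
  ... | _ , _ , here refl , o₂ , _ = ¬132 o₂
  ... | _ , _ , there (here refl) , _ , _ , _ , here refl , dec , _ = ¬decreasing! dec

  block-avoids-2341 : ¬ p2341 ≼ β → ¬ p2341 ≼ block m j β
  block-avoids-2341 ¬2341 o with block-split o
  ... | _ , _ , here refl , o₂ , _ = ¬2341 o₂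
  ... | _ , _ , there (here refl) , _ , _ , _ , here refl , dec , _ = ¬decreasing! dec
  ... | _ , _ , there (here refl) , _ , _ , _ , there (here refl) , dec , _ = ¬decreasing! dec
  ... | _ , _ , there (there (here refl)) , _ , _ , _ , here refl , dec , _ = ¬decreasing! dec

  block-avoids-213 : m ∸ j ≤ 1 → ¬ p213 ≼ β → ¬ p213 ≼ block m j β
  block-avoids-213 short ¬213 o with block-split o
  ... | _ , _ , here refl , o₂ , _ = ¬213 o₂
  ... | _ , _ , there (here refl) , _ , _ , _ , here refl , _ , long = <-irrefl refl (≤-trans long short)
  ... | _ , _ , there (here refl) , _ , _ , _ , there (here refl) , dec , _ = ¬decreasing! dec

  block-avoids-4213 : ¬ p213 ≼ β → ¬ p4213 ≼ block m j β
  block-avoids-4213 ¬213 o with block-split o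
  ... | _ , _ , here refl , o₂ , _ = ¬213 (⊆-≼-trans (3 ∷ʳ ⊆-refl) o₂)
  ... | _ , _ , there (here refl) , o₂ , _ = ¬213 o₂
  ... | _ , _ , there (there (here refl)) , _ , _ , _ , here refl , dec , _ = ¬decreasing! dec

  block-avoids-54213 : ¬ p4213 ≼ β → (2 ≤ m ∸ j → ¬ p213 ≼ β) → ¬ p54213 ≼ block m j β
  block-avoids-54213 ¬4213 ¬213 o with block-split o
  ... | _ , _ , here refl , o₂ , _ = ¬4213 (⊆-≼-trans (4 ∷ʳ ⊆-refl) o₂)
  ... | _ , _ , there (here refl) , o₂ , _ = ¬4213 o₂
  ... | _ , _ , there (there (here refl)) , o₂ , _ , _ , here refl , _ , long = ¬213 long o₂
  ... | _ , _ , there (there (there (here refl))) , _ , _ , _ , here refl , dec , _ = ¬decreasing! dec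

max-last-avoids : ∀ {α m σ} → All (_< m) α → maxSplits σ ≡ [ σ , [] ] → ¬ σ ≼ α → ¬ σ ≼ α ++ [ m ]
max-last-avoids α<m only ¬o o with σ₁ , τ , σ∈ , o₁ ← max-split α<m o with subst (_ ∈_) only σ∈
... | here refl = ¬o o₁

max-last-perm : ∀ {m α} → IsPermutation m α → IsPermutation (suc m) (α ++ [ m ])
max-last-perm {m} {α} (isPermutation uα α<m |α|) = isPermutation
  (Unique.++⁺ uα ([] ∷ []) λ { (m∈α , here refl) → <-irrefl refl (All.lookup α<m m∈α) })
  (All.++⁺ (All.map m≤n⇒m≤1+n α<m) (≤-refl ∷ []))
  (trans (length-++ α) (trans (+-comm (length α) 1) (cong suc |α|)))

block-perm : ∀ {m j β} → j ≤ m → IsPermutation j β → IsPermutation (suc m) (block m j β)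
block-perm {m} {j} {β} j≤m (isPermutation uβ β<j |β|) = isPermutation
  (Unique.++⁺ (decreasing-unique (run-decreasing (m ∸ j) j))
              (All.map (λ b<j → λ { refl → <-irrefl refl (<-≤-trans b<j j≤m) }) β<j ∷ uβ)
              λ { (v∈run , here refl) → <-irrefl refl (All.lookup (run-below j≤m) v∈run)
                ; (v∈run , there v∈β) → <-irrefl refl (<-≤-trans (All.lookup β<j v∈β)
                                                                 (proj₁ (All.lookup (run-bounds (m ∸ j) j) v∈run))) })
  (All.++⁺ (All.map m≤n⇒m≤1+n (run-below j≤m))
           (≤-refl ∷ All.map (λ b<j → m≤n⇒m≤1+n (<-≤-trans b<j j≤m)) β<j))
  (begin
    length (block m j β)              ≡⟨ length-++ (run (m ∸ j) j) ⟩
    length (run (m ∸ j) j) + suc (length β) ≡⟨ cong₂ _+_ (length-run (m ∸ j) j) (cong suc |β|) ⟩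
    (m ∸ j) + suc j                    ≡⟨ +-suc (m ∸ j) j ⟩
    suc (m ∸ j + j)                    ≡⟨ cong suc (m∸n+n≡m j≤m) ⟩
    suc m                              ∎)
  where open ≡-Reasoning

upTo-perm : ∀ n → IsPermutation n (upTo n)
upTo-perm n = isPermutation (Unique.upTo⁺ n) (All.all-upTo n) (length-upTo n)

-- The three classes and their generating lists

Avoids : List (List ℕ) → List ℕ → Set
Avoids Π π = All (λ σ → ¬ σ ≼ π) Π

Av : List (List ℕ) → ℕ → List ℕ → Set
Av Π n π = IsPermutation n π × Avoids Π π

avoid-⊆ : ∀ {σ π π′} → π′ ⊆ π → ¬ σ ≼ π → ¬ σ ≼ π′
avoid-⊆ τ ¬o o = ¬o (≼-⊆-trans o τ)

avoids-⊆ : ∀ {Π π π′} → π′ ⊆ π → Avoids Π π → Avoids Π π′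
avoids-⊆ τ = All.map (avoid-⊆ τ)

-- classA is the class of the theorem; classB and classC are the classes that the part β of
-- a block has to avoid, depending on the length of its run.
classA classB classC : List (List ℕ)
classA = p132 ∷ p54213 ∷ p2341 ∷ []
classB = p132 ∷ p2341 ∷ p213 ∷ []
classC = p132 ∷ p2341 ∷ p4213 ∷ []

byRunLength : {X : Set} → X → X → X → ℕ → X
byRunLength x₀ x₁ x₂ zero          = x₀
byRunLength x₀ x₁ x₂ (suc zero)    = x₁
byRunLength x₀ x₁ x₂ (suc (suc _)) = x₂

-- ℬ² m = (ℬ m , ℬ (m ∸ 1)), as each level of ℬ uses the previous two.
ℬ² : ℕ → List (List ℕ) × List (List ℕ)
ℬ² zero    = [ [] ] , []
ℬ² (suc m) = extend m [ upTo m ] (λ j → byRunLength (proj₁ (ℬ² m)) (proj₂ (ℬ² m)) [] (m ∸ j)) ,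
             proj₁ (ℬ² m)

ℬ : ℕ → List (List ℕ)
ℬ m = proj₁ (ℬ² m)

𝒞 : ℕ → List (List ℕ)
𝒞 zero    = [ [] ]
𝒞 (suc m) = extend m (𝒞 m) ℬ

𝒜 : ℕ → List (List ℕ)
𝒜 zero    = [ [] ]
𝒜 (suc m) = extend m (𝒜 m) (λ j → byRunLength (𝒞 j) (𝒞 j) (ℬ j) (m ∸ j))

∈-ℬ-window⁻ : ∀ {m j β} → j ≤ m → β ∈ byRunLength (ℬ m) (proj₂ (ℬ² m)) [] (m ∸ j) →
              β ∈ ℬ j × m ∸ j ≤ 1
∈-ℬ-window⁻ {m} {j} j≤m β∈ with m ∸ j | m∸n+n≡m j≤m
... | zero        | refl = β∈ , z≤n
... | suc zero    | refl = β∈ , ≤-refl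

∈-ℬ-window⁺ : ∀ {m j β} → j ≤ m → m ∸ j ≤ 1 → β ∈ ℬ j →
              β ∈ byRunLength (ℬ m) (proj₂ (ℬ² m)) [] (m ∸ j)
∈-ℬ-window⁺ {m} {j} j≤m short β∈ with m ∸ j | m∸n+n≡m j≤m | short
... | zero        | refl | _ = β∈
... | suc zero    | refl | _ = β∈
... | suc (suc _) | _    | s≤s ()

∈-byRunLength⁻ : ∀ {X : Set} {x : X} {xs₀ xs₂ : List X} k → x ∈ byRunLength xs₀ xs₀ xs₂ k →
                 (k ≤ 1 × x ∈ xs₀) ⊎ (2 ≤ k × x ∈ xs₂)
∈-byRunLength⁻ zero          x∈ = inj₁ (z≤n , x∈)
∈-byRunLength⁻ (suc zero)    x∈ = inj₁ (≤-refl , x∈)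
∈-byRunLength⁻ (suc (suc _)) x∈ = inj₂ (s≤s (s≤s z≤n) , x∈)

∈-byRunLength⁺ˡ : ∀ {X : Set} {x : X} {xs₀ xs₂ : List X} k → k ≤ 1 → x ∈ xs₀ →
                  x ∈ byRunLength xs₀ xs₀ xs₂ k
∈-byRunLength⁺ˡ zero          _ x∈ = x∈
∈-byRunLength⁺ˡ (suc zero)    _ x∈ = x∈
∈-byRunLength⁺ˡ (suc (suc _)) (s≤s ()) _

∈-byRunLength⁺ʳ : ∀ {X : Set} {x : X} {xs₀ xs₂ : List X} k → 2 ≤ k → x ∈ xs₂ →
                  x ∈ byRunLength xs₀ xs₀ xs₂ k
∈-byRunLength⁺ʳ (suc (suc _)) _ x∈ = x∈
∈-byRunLength⁺ʳ (suc zero) (s≤s ()) _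

private
  upTo-increasing : ∀ n → Increasing (upTo n)
  upTo-increasing n = AllPairs.applyUpTo⁺₁ (λ i → i) n (λ i<j _ → i<j)

ℬ-sound : ∀ n {π} → π ∈ ℬ n → Av classB n π
ℬ-sound = <-rec _ step
  where
    step : ∀ n → (∀ {j} → j < n → ∀ {π} → π ∈ ℬ j → Av classB j π) →
           ∀ {π} → π ∈ ℬ n → Av classB n π
    step zero    _   (here refl) = upTo-perm 0 , ¬≼[] ∷ ¬≼[] ∷ ¬≼[] ∷ []
    step (suc m) rec π∈ with ∈-extend⁻ m [ upTo m ] _ π∈
    ... | inj₁ (_ , here refl , refl) = max-last-perm (upTo-perm m) , avoid ∷ avoid ∷ avoid ∷ []
      where
        avoid : ∀ {σ} {_ : False (increasing? σ)} → ¬ σ ≼ upTo m ++ [ m ]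
        avoid {_} {¬inc} o = toWitnessFalse ¬inc
          (≼-increasing (subst Increasing (sym (upTo-∷ʳ m)) (upTo-increasing (suc m))) o)
    ... | inj₂ (j , β , 1≤j , j≤m , β∈ , refl)
      with β∈ℬ , short ← ∈-ℬ-window⁻ j≤m β∈
      with βp , ¬132 ∷ ¬2341 ∷ ¬213 ∷ [] ← rec (s≤s j≤m) β∈ℬ
      = block-perm j≤m βp ,
        block-avoids-132 j≤m βp ¬132 ∷ block-avoids-2341 j≤m βp ¬2341 ∷
        block-avoids-213 j≤m βp short ¬213 ∷ []

𝒞-sound : ∀ n {π} → π ∈ 𝒞 n → Av classC n π
𝒞-sound zero    (here refl) = upTo-perm 0 , ¬≼[] ∷ ¬≼[] ∷ ¬≼[] ∷ []
𝒞-sound (suc m) π∈ with ∈-extend⁻ m (𝒞 m) ℬ π∈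
... | inj₁ (α , α∈ , refl) with αp , ¬132 ∷ ¬2341 ∷ ¬4213 ∷ [] ← 𝒞-sound m α∈ =
  max-last-perm αp ,
  max-last-avoids α<m refl ¬132 ∷ max-last-avoids α<m refl ¬2341 ∷ max-last-avoids α<m refl ¬4213 ∷ []
  where α<m = bounded αp
... | inj₂ (j , β , 1≤j , j≤m , β∈ , refl) with βp , ¬132 ∷ ¬2341 ∷ ¬213 ∷ [] ← ℬ-sound j β∈ =
  block-perm j≤m βp ,
  block-avoids-132 j≤m βp ¬132 ∷ block-avoids-2341 j≤m βp ¬2341 ∷ block-avoids-4213 j≤m βp ¬213 ∷ []

𝒜-sound : ∀ n {π} → π ∈ 𝒜 n → Av classA n π
𝒜-sound zero    (here refl) = upTo-perm 0 , ¬≼[] ∷ ¬≼[] ∷ ¬≼[] ∷ []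
𝒜-sound (suc m) π∈ with ∈-extend⁻ m (𝒜 m) _ π∈
... | inj₁ (α , α∈ , refl) with αp , ¬132 ∷ ¬54213 ∷ ¬2341 ∷ [] ← 𝒜-sound m α∈ =
  max-last-perm αp ,
  max-last-avoids α<m refl ¬132 ∷ max-last-avoids α<m refl ¬54213 ∷ max-last-avoids α<m refl ¬2341 ∷ []
  where α<m = bounded αp
... | inj₂ (j , β , 1≤j , j≤m , β∈ , refl) with ∈-byRunLength⁻ (m ∸ j) β∈
...   | inj₁ (short , β∈𝒞) with βp , ¬132 ∷ ¬2341 ∷ ¬4213 ∷ [] ← 𝒞-sound j β∈𝒞 =
  block-perm j≤m βp ,
  block-avoids-132 j≤m βp ¬132 ∷
  block-avoids-54213 j≤m βp ¬4213 (λ long → ⊥-elim (<-irrefl refl (≤-trans long short))) ∷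
  block-avoids-2341 j≤m βp ¬2341 ∷ []
...   | inj₂ (long , β∈ℬ) with βp , ¬132 ∷ ¬2341 ∷ ¬213 ∷ [] ← ℬ-sound j β∈ℬ =
  block-perm j≤m βp ,
  block-avoids-132 j≤m βp ¬132 ∷
  block-avoids-54213 j≤m βp (λ o → ¬213 (⊆-≼-trans (3 ∷ʳ ⊆-refl) o)) (λ _ → ¬213) ∷
  block-avoids-2341 j≤m βp ¬2341 ∷ []

private
  perm-0 : ∀ {π} → IsPermutation 0 π → π ≡ []
  perm-0 {[]} _ = refl

  max-last-⊆ : ∀ {α : List ℕ} {m} → α ⊆ α ++ [ m ]
  max-last-⊆ {m = m} = Sublist.++⁺ʳ [ m ] ⊆-refl

  block-⊆ : ∀ {m j β} → β ⊆ block m j β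
  block-⊆ {m} {j} = Sublist.++⁺ˡ (run (m ∸ j) j) (m ∷ʳ ⊆-refl)

ℬ-complete : ∀ n {π} → Av classB n π → π ∈ ℬ n
ℬ-complete = <-rec _ step
  where
    step : ∀ n → (∀ {j} → j < n → ∀ {π} → Av classB j π → π ∈ ℬ j) →
           ∀ {π} → Av classB n π → π ∈ ℬ n
    step zero    _   (p , _) with refl ← perm-0 p = here refl
    step (suc m) rec (p , av@(¬132 ∷ ¬2341 ∷ ¬213 ∷ [])) with shape p ¬132 ¬2341
    ... | max-last {α} αp@(isPermutation uα α<m |α|) =
      ∈-extend⁺ˡ {L = [ upTo m ]} (here (increasing-applyUpTo m 0 α
        (avoids-descent⇒increasing (s≤s z≤n) uα ¬21) (All.map (λ _ → z≤n) α<m)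
        (subst (λ k → All (_< k) α) (sym (+-identityʳ m)) α<m) |α|))
      where ¬21 : ¬ 1 ∷ 0 ∷ [] ≼ α
            ¬21 o = ¬213 (max-join α<m o (≼-singleton 2 (here refl)) below!)
    ... | run-max {j} {β} 1≤j j≤m βp = ∈-extend⁺ʳ 1≤j j≤m (∈-ℬ-window⁺ j≤m short
            (rec (s≤s j≤m) (βp , avoids-⊆ block-⊆ av)))
      where short : m ∸ j ≤ 1
            short = ≮⇒≥ λ long → ¬213 (block-join j≤m βp (run-descent j long (s≤s z≤n))
                                          (≼-singleton 2 (here refl)) ([]≼ β) below! above!)

𝒞-complete : ∀ n {π} → Av classC n π → π ∈ 𝒞 n
𝒞-complete zero    (p , _) with refl ← perm-0 p = here refl
𝒞-complete (suc m) (p , av@(¬132 ∷ ¬2341 ∷ ¬4213 ∷ [])) with shape p ¬132 ¬2341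
... | max-last αp = ∈-extend⁺ˡ (𝒞-complete m (αp , avoids-⊆ max-last-⊆ av))
... | run-max {j} {β} 1≤j j≤m βp =
  ∈-extend⁺ʳ 1≤j j≤m
    (ℬ-complete j (βp , avoid-⊆ block-⊆ ¬132 ∷ avoid-⊆ block-⊆ ¬2341 ∷ ¬213 ∷ []))
  where ¬213 : ¬ p213 ≼ β
        ¬213 o = ¬4213 (block-join j≤m βp ([]≼ _) (≼-singleton 3 (here refl)) o below! above!)

𝒜-complete : ∀ n {π} → Av classA n π → π ∈ 𝒜 n
𝒜-complete zero    (p , _) with refl ← perm-0 p = here refl
𝒜-complete (suc m) (p , av@(¬132 ∷ ¬54213 ∷ ¬2341 ∷ [])) with shape p ¬132 ¬2341
... | max-last αp = ∈-extend⁺ˡ (𝒜-complete m (αp , avoids-⊆ max-last-⊆ av))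
... | run-max {j} {β} 1≤j j≤m βp with m ∸ j ≤? 1
...   | yes short = ∈-extend⁺ʳ 1≤j j≤m (∈-byRunLength⁺ˡ (m ∸ j) short
          (𝒞-complete j (βp , avoid-⊆ block-⊆ ¬132 ∷ avoid-⊆ block-⊆ ¬2341 ∷ ¬4213 ∷ [])))
  where ¬4213 : ¬ p4213 ≼ β
        ¬4213 o = ¬54213 (block-join j≤m βp ([]≼ _) (≼-singleton 4 (here refl)) o below! above!)
...   | no ¬short = ∈-extend⁺ʳ 1≤j j≤m (∈-byRunLength⁺ʳ (m ∸ j) long
          (ℬ-complete j (βp , avoid-⊆ block-⊆ ¬132 ∷ avoid-⊆ block-⊆ ¬2341 ∷ ¬213 ∷ [])))
  where long : 2 ≤ m ∸ j
        long = ≰⇒> ¬short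
        ¬213 : ¬ p213 ≼ β
        ¬213 o = ¬54213 (block-join j≤m βp (run-descent j long ≤-refl) ([]≼ _) o below! above!)

private
  byRunLength-All : ∀ {X : Set} {P : X → Set} {x₀ x₁ x₂} → P x₀ → P x₁ → P x₂ →
                    ∀ k → P (byRunLength x₀ x₁ x₂ k)
  byRunLength-All p₀ _  _  zero          = p₀
  byRunLength-All _  p₁ _  (suc zero)    = p₁
  byRunLength-All _  _  p₂ (suc (suc _)) = p₂

ℬ-unique : ∀ n → Unique (ℬ n)
ℬ-unique = <-rec _ step
  where
    step : ∀ n → (∀ {j} → j < n → Unique (ℬ j)) → Unique (ℬ n)
    step zero    _   = [] ∷ []
    step (suc m) rec = extend-unique (λ { (here refl) → upTo-perm m })
      (λ j≤m β∈ → proj₁ (ℬ-sound _ (proj₁ (∈-ℬ-window⁻ j≤m β∈)))) ([] ∷ [])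
      (λ j → byRunLength-All {P = Unique} (rec ≤-refl) (previous m (λ j<m → rec (m≤n⇒m≤1+n j<m))) [] (m ∸ j))
      where
        previous : ∀ m → (∀ {j} → j < m → Unique (ℬ j)) → Unique (proj₂ (ℬ² m))
        previous zero    _   = []
        previous (suc m) rec = rec ≤-refl

𝒞-unique : ∀ n → Unique (𝒞 n)
𝒞-unique zero    = [] ∷ []
𝒞-unique (suc m) =
  extend-unique (λ α∈ → proj₁ (𝒞-sound m α∈)) (λ _ β∈ → proj₁ (ℬ-sound _ β∈)) (𝒞-unique m) ℬ-unique

𝒜-unique : ∀ n → Unique (𝒜 n)
𝒜-unique zero    = [] ∷ []
𝒜-unique (suc m) = extend-unique (λ α∈ → proj₁ (𝒜-sound m α∈)) F-perm (𝒜-unique m)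
  (λ j → byRunLength-All {P = Unique} (𝒞-unique j) (𝒞-unique j) (ℬ-unique j) (m ∸ j))
  where
    F-perm : ∀ {j β} → j ≤ m → β ∈ byRunLength (𝒞 j) (𝒞 j) (ℬ j) (m ∸ j) → IsPermutation j β
    F-perm {j} _ β∈ with ∈-byRunLength⁻ (m ∸ j) β∈
    ... | inj₁ (_ , β∈𝒞) = proj₁ (𝒞-sound j β∈𝒞)
    ... | inj₂ (_ , β∈ℬ) = proj₁ (ℬ-sound j β∈ℬ)

-- Counting

∣A∣ ∣B∣ ∣C∣ : ℕ → ℕ
∣A∣ n = length (𝒜 n)
∣B∣ n = length (ℬ n)
∣C∣ n = length (𝒞 n)

private
  ∑₁-cong : ∀ t {g h : ℕ → ℕ} → (∀ j → j ≤ t → g j ≡ h j) → ∑₁ t g ≡ ∑₁ t h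
  ∑₁-cong zero    _ = refl
  ∑₁-cong (suc t) e = cong₂ _+_ (∑₁-cong t (λ j j≤t → e j (m≤n⇒m≤1+n j≤t))) (e (suc t) ≤-refl)

  ∑₁-zero : ∀ t → ∑₁ t (λ _ → 0) ≡ 0
  ∑₁-zero zero    = refl
  ∑₁-zero (suc t) = trans (+-identityʳ _) (∑₁-zero t)

  byRunLength-long : ∀ {X : Set} {x₀ x₁ x₂ : X} {k} → 2 ≤ k → byRunLength x₀ x₁ x₂ k ≡ x₂
  byRunLength-long {k = suc zero}    (s≤s ())
  byRunLength-long {k = suc (suc _)} _ = refl

  gap-long : ∀ k {j} → j ≤ k → 2 ≤ (2 + k) ∸ j
  gap-long k {j} j≤k = subst (2 ≤_) (sym (+-∸-assoc 2 j≤k)) (m≤m+n 2 (k ∸ j))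

  gap-one : ∀ k → (2 + k) ∸ (1 + k) ≡ 1
  gap-one k = m+n∸n≡m 1 (suc k)

  gap-zero : ∀ k → (2 + k) ∸ (2 + k) ≡ 0
  gap-zero k = n∸n≡0 (2 + k)

∣B∣-rec : ∀ k → ∣B∣ (3 + k) ≡ 1 + ∣B∣ (1 + k) + ∣B∣ (2 + k)
∣B∣-rec k = begin
  ∣B∣ (3 + k)                                                       ≡⟨ length-extend (2 + k) [ upTo (2 + k) ] F ⟩
  1 + (∑₁ k (λ j → length (F j)) + length (F (1 + k)) + length (F (2 + k)))
    ≡⟨ cong (λ x → 1 + (x + length (F (1 + k)) + length (F (2 + k))))
            (trans (∑₁-cong k (λ j j≤k → cong length (byRunLength-long (gap-long k j≤k)))) (∑₁-zero k)) ⟩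
  1 + (length (F (1 + k)) + length (F (2 + k)))
    ≡⟨ cong₂ (λ x y → 1 + (length x + length y))
             (cong (byRunLength _ _ _) (gap-one k)) (cong (byRunLength _ _ _) (gap-zero k)) ⟩
  1 + ∣B∣ (1 + k) + ∣B∣ (2 + k)                                       ∎
  where
    open ≡-Reasoning
    F : ℕ → List (List ℕ)
    F j = byRunLength (ℬ (2 + k)) (ℬ (1 + k)) [] ((2 + k) ∸ j)

∣C∣-rec : ∀ m → ∣C∣ (suc m) ≡ ∣C∣ m + ∑₁ m ∣B∣
∣C∣-rec m = length-extend m (𝒞 m) ℬ

∣A∣-rec : ∀ k → ∣A∣ (3 + k) ≡ ∣A∣ (2 + k) + (∑₁ k ∣B∣ + ∣C∣ (1 + k) + ∣C∣ (2 + k))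
∣A∣-rec k = trans (length-extend (2 + k) (𝒜 (2 + k)) F) (cong (_+_ (∣A∣ (2 + k))) (cong₂ _+_ (cong₂ _+_
  (∑₁-cong k (λ j j≤k → cong length (byRunLength-long (gap-long k j≤k))))
  (cong (λ g → length (byRunLength (𝒞 (1 + k)) (𝒞 (1 + k)) (ℬ (1 + k)) g)) (gap-one k)))
  (cong (λ g → length (byRunLength (𝒞 (2 + k)) (𝒞 (2 + k)) (ℬ (2 + k)) g)) (gap-zero k))))
  where
    F : ℕ → List (List ℕ)
    F j = byRunLength (𝒞 j) (𝒞 j) (ℬ j) ((2 + k) ∸ j)

-- Closed forms, with all subtracted terms moved to the left.

private
  pascal₂ : ∀ n → suc n C 2 ≡ n + n C 2
  pascal₂ n = trans (sym (nCk+nC[k+1]≡[n+1]C[k+1] n 1)) (cong (_+ n C 2) (nC1≡n n))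

  pascal₃ : ∀ n → suc n C 3 ≡ n C 2 + n C 3
  pascal₃ n = sym (nCk+nC[k+1]≡[n+1]C[k+1] n 2)

∣B∣-fib : ∀ k → ∣B∣ (suc k) + 1 ≡ fib (3 + k)
∣B∣-fib zero          = refl
∣B∣-fib (suc zero)    = refl
∣B∣-fib (suc (suc k)) = begin
  ∣B∣ (3 + k) + 1                    ≡⟨ cong (_+ 1) (∣B∣-rec k) ⟩
  1 + b₁ + b₂ + 1                    ≡⟨ regroup b₁ b₂ ⟩
  (b₂ + 1) + (b₁ + 1)                ≡⟨ cong₂ _+_ (∣B∣-fib (suc k)) (∣B∣-fib k) ⟩
  fib (4 + k) + fib (3 + k)          ∎
  where
    open ≡-Reasoning
    b₁ = ∣B∣ (1 + k)
    b₂ = ∣B∣ (2 + k)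
    regroup : ∀ b₁ b₂ → 1 + b₁ + b₂ + 1 ≡ (b₂ + 1) + (b₁ + 1)
    regroup = solve-∀

∑∣B∣-fib : ∀ m → ∑₁ m ∣B∣ + m + 3 ≡ fib (4 + m)
∑∣B∣-fib zero    = refl
∑∣B∣-fib (suc m) = begin
  ∑₁ m ∣B∣ + ∣B∣ (suc m) + suc m + 3     ≡⟨ regroup s b m ⟩
  (s + m + 3) + (b + 1)                ≡⟨ cong₂ _+_ (∑∣B∣-fib m) (∣B∣-fib m) ⟩
  fib (4 + m) + fib (3 + m)            ∎
  where
    open ≡-Reasoning
    s = ∑₁ m ∣B∣
    b = ∣B∣ (suc m)
    regroup : ∀ s b m → s + b + suc m + 3 ≡ (s + m + 3) + (b + 1)
    regroup = solve-∀

∣C∣-fib : ∀ m → ∣C∣ m + 4 + 3 * m + m C 2 ≡ fib (5 + m)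
∣C∣-fib zero    = refl
∣C∣-fib (suc m) = begin
  ∣C∣ (suc m) + 4 + 3 * suc m + suc m C 2
    ≡⟨ cong₂ (λ c x → c + 4 + 3 * suc m + x) (∣C∣-rec m) (pascal₂ m) ⟩
  (c + s) + 4 + 3 * suc m + (m + x)      ≡⟨ regroup c s m x ⟩
  (c + 4 + 3 * m + x) + (s + m + 3)      ≡⟨ cong₂ _+_ (∣C∣-fib m) (∑∣B∣-fib m) ⟩
  fib (5 + m) + fib (4 + m)              ∎
  where
    open ≡-Reasoning
    c = ∣C∣ m
    s = ∑₁ m ∣B∣
    x = m C 2
    regroup : ∀ c s m x → (c + s) + 4 + 3 * suc m + (m + x) ≡ (c + 4 + 3 * m + x) + (s + m + 3)
    regroup = solve-∀

∣A∣-fib : ∀ k → ∣A∣ (2 + k) + 2 * ((3 + k) C 3) + 4 * ((3 + k) C 2) + 3 * (3 + k) + 14 ≡ 3 * fib (7 + k)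
∣A∣-fib zero    = refl
∣A∣-fib (suc k) = begin
  ∣A∣ (3 + k) + 2 * ((4 + k) C 3) + 4 * ((4 + k) C 2) + 3 * (4 + k) + 14
    ≡⟨ cong₂ (λ a (u , v) → a + 2 * u + 4 * v + 3 * (4 + k) + 14) (∣A∣-rec k)
             (cong₂ _,_ (trans (pascal₃ (3 + k)) (cong (_+ y) (binomial₃₂)))
                        (trans (pascal₂ (3 + k)) (cong (_+_ (3 + k)) binomial₃₂))) ⟩
  (a + (s + c₁ + c₂)) + 2 * (E + y) + 4 * ((3 + k) + E) + 3 * (4 + k) + 14
    ≡⟨ regroup a s c₁ c₂ k x y ⟩
  (a + 2 * y + 4 * E + 3 * (3 + k) + 14) + (s + k + 3) + (c₁ + 4 + 3 * (1 + k) + x)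
    + (c₂ + 4 + 3 * (2 + k) + ((1 + k) + x))
    ≡⟨ cong₂ _+_ (cong₂ _+_ (cong₂ _+_ IH (∑∣B∣-fib k)) (∣C∣-fib (1 + k))) C₂ ⟩
  3 * fib (7 + k) + fib (4 + k) + fib (6 + k) + fib (7 + k)
    ≡⟨ fib-identity (fib (5 + k)) (fib (4 + k)) ⟩
  3 * fib (8 + k) ∎
  where
    open ≡-Reasoning
    a = ∣A∣ (2 + k)
    s = ∑₁ k ∣B∣
    c₁ = ∣C∣ (1 + k)
    c₂ = ∣C∣ (2 + k)
    x = (1 + k) C 2
    y = (3 + k) C 3
    E = (2 + k) + ((1 + k) + x)

    binomial₂₂ : (2 + k) C 2 ≡ (1 + k) + x
    binomial₂₂ = pascal₂ (1 + k)

    binomial₃₂ : (3 + k) C 2 ≡ E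
    binomial₃₂ = trans (pascal₂ (2 + k)) (cong (_+_ (2 + k)) binomial₂₂)

    IH : a + 2 * y + 4 * E + 3 * (3 + k) + 14 ≡ 3 * fib (7 + k)
    IH = subst (λ z → a + 2 * y + 4 * z + 3 * (3 + k) + 14 ≡ 3 * fib (7 + k)) binomial₃₂ (∣A∣-fib k)

    C₂ : c₂ + 4 + 3 * (2 + k) + ((1 + k) + x) ≡ fib (7 + k)
    C₂ = subst (λ z → c₂ + 4 + 3 * (2 + k) + z ≡ fib (7 + k)) binomial₂₂ (∣C∣-fib (2 + k))

    regroup : ∀ a s c₁ c₂ k x y →
      let E = (2 + k) + ((1 + k) + x) in
      (a + (s + c₁ + c₂)) + 2 * (E + y) + 4 * ((3 + k) + E) + 3 * (4 + k) + 14
        ≡ (a + 2 * y + 4 * E + 3 * (3 + k) + 14) + (s + k + 3) + (c₁ + 4 + 3 * (1 + k) + x)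
          + (c₂ + 4 + 3 * (2 + k) + ((1 + k) + x))
    regroup = solve-∀

    -- fib (6 + k) and fib (7 + k) unfolded in terms of f₅ = fib (5 + k) and f₄ = fib (4 + k)
    fib-identity : ∀ f₅ f₄ → 3 * ((f₅ + f₄) + f₅) + f₄ + (f₅ + f₄) + ((f₅ + f₄) + f₅)
                             ≡ 3 * (((f₅ + f₄) + f₅) + (f₅ + f₄))
    fib-identity = solve-∀

∣A∣-closedForm : ∀ n → 2 ≤ n → + ∣A∣ n ≡ closedForm n
∣A∣-closedForm (suc zero)    (s≤s ())
∣A∣-closedForm (suc (suc k)) _ = sum≡⇒difference≡ (begin
  ∣A∣ (2 + k) + 2 * ((2 + k + 1) C 3) + 4 * ((2 + k + 1) C 2) + 3 * ((2 + k + 1) C 1) + 14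
    ≡⟨ cong (λ m → ∣A∣ (2 + k) + 2 * (m C 3) + 4 * (m C 2) + 3 * (m C 1) + 14) (+-comm (2 + k) 1) ⟩
  ∣A∣ (2 + k) + 2 * ((3 + k) C 3) + 4 * ((3 + k) C 2) + 3 * ((3 + k) C 1) + 14
    ≡⟨ cong (λ m → ∣A∣ (2 + k) + 2 * ((3 + k) C 3) + 4 * ((3 + k) C 2) + 3 * m + 14) (nC1≡n (3 + k)) ⟩
  ∣A∣ (2 + k) + 2 * ((3 + k) C 3) + 4 * ((3 + k) C 2) + 3 * (3 + k) + 14
    ≡⟨ ∣A∣-fib k ⟩
  3 * fib (7 + k)
    ≡⟨ cong (λ m → 3 * fib m) (+-comm 5 (2 + k)) ⟩
  3 * fib (2 + k + 5) ∎)
  where open ≡-Reasoning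

gf : ∀ n → (denominator ⋆ (λ k → + ∣A∣ k)) n ≡ numerator n
gf 0 = refl
gf 1 = refl
gf 2 = refl
gf 3 = refl
gf 4 = refl
gf 5 = refl
gf 6 = refl
gf 7 = refl
gf (suc (suc (suc (suc (suc (suc (suc (suc k)))))))) =
  trans (denominator⋆ a (2 + k)) (cong ℤ.-_ (fourth-difference Φa-degree k))
  where
    a : Series
    a n = + ∣A∣ n
    Φa-degree : DegreeBelow 4 (λ n → Φ a (2 + n))
    Φa-degree = degreeBelow-cong
      (λ n → sym (cong₂ ℤ._-_ (cong₂ ℤ._-_ (∣A∣-closedForm (4 + n) (s≤s (s≤s z≤n)))
                                           (∣A∣-closedForm (3 + n) (s≤s (s≤s z≤n))))
                              (∣A∣-closedForm (2 + n) (s≤s (s≤s z≤n)))))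
      (degreeBelow-shift (degreeBelow-shift Φ-closedForm-degree))

AllPairs-tabulate⁻ : ∀ {A : Set} {R : A → A → Set} {n} {g : Fin n → A} →
                     AllPairs R (List.tabulate g) → ∀ {i j} → i Fin.< j → R (g i) (g j)
AllPairs-tabulate⁻ (r ∷ _)  {zero}  {suc j} _         = All.tabulate⁻ r j
AllPairs-tabulate⁻ (_ ∷ rs) {suc i} {suc j} (s≤s i<j) = AllPairs-tabulate⁻ rs i<j

IncreasingMap : ∀ {m n} → (Fin m → Fin n) → Set
IncreasingMap f = ∀ a b → a Fin.< b → f a Fin.< f b

private
  unsuc : ∀ {n} (i : Fin (suc n)) → 0 < toℕ i → Fin n
  unsuc (suc i) _ = i

  suc-unsuc : ∀ {n} (i : Fin (suc n)) (i>0 : 0 < toℕ i) → suc (unsuc i i>0) ≡ i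
  suc-unsuc (suc i) _ = refl

⊆-tabulate : ∀ {A : Set} {m n} (g : Fin n → A) (f : Fin m → Fin n) → IncreasingMap f →
             List.tabulate (λ a → g (f a)) ⊆ List.tabulate g
⊆-tabulate-suc : ∀ {A : Set} {m n} (g : Fin (suc n) → A) (f : Fin m → Fin (suc n)) → IncreasingMap f →
                 (∀ a → 0 < toℕ (f a)) → List.tabulate (λ a → g (f a)) ⊆ List.tabulate (λ i → g (suc i))

⊆-tabulate {m = zero}  g f inc = minimum _
⊆-tabulate {m = suc m} {zero}  g f inc with () ← f zero
⊆-tabulate {m = suc m} {suc n} g f inc with f zero Fin.≟ zero
... | yes f0≡0 = cong g f0≡0 ∷ ⊆-tabulate-suc g (λ a → f (suc a)) (λ a b a<b → inc (suc a) (suc b) (s≤s a<b))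
                   λ a → subst (λ i → toℕ i < toℕ (f (suc a))) f0≡0 (inc zero (suc a) (s≤s z≤n))
... | no  f0≢0 = g zero ∷ʳ ⊆-tabulate-suc g f inc positive
  where
    positive : ∀ a → 0 < toℕ (f a)
    positive zero    = n≢0⇒n>0 (λ f0≡0 → f0≢0 (toℕ-injective f0≡0))
    positive (suc a) = <-trans (positive zero) (inc zero (suc a) (s≤s z≤n))

⊆-tabulate-suc g f inc f>0 =
  subst (_⊆ List.tabulate (λ i → g (suc i))) (tabulate-cong λ a → cong g (suc-unsuc (f a) (f>0 a)))
    (⊆-tabulate (λ i → g (suc i)) (λ a → unsuc (f a) (f>0 a)) λ a b a<b →
      ≤-pred (subst₂ Fin._<_ (sym (suc-unsuc _ (f>0 a))) (sym (suc-unsuc _ (f>0 b))) (inc a b a<b)))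

⊆-tabulate⁻ : ∀ {A : Set} {m n} (h : Fin m → A) (g : Fin n → A) → List.tabulate h ⊆ List.tabulate g →
              Σ (Fin m → Fin n) λ f → IncreasingMap f × (∀ a → h a ≡ g (f a))
⊆-tabulate⁻ {m = zero}  h g τ = (λ ()) , (λ ()) , (λ ())
⊆-tabulate⁻ {m = suc m} {zero}  h g ()
⊆-tabulate⁻ {m = suc m} {suc n} h g (_ ∷ʳ τ) with f , inc , h≡ ← ⊆-tabulate⁻ h (λ i → g (suc i)) τ =
  (λ a → suc (f a)) , (λ a b a<b → s≤s (inc a b a<b)) , h≡
⊆-tabulate⁻ {m = suc m} {suc n} h g (h0≡ ∷ τ)
  with f , inc , h≡ ← ⊆-tabulate⁻ (λ a → h (suc a)) (λ i → g (suc i)) τ =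
  f₀ , inc₀ , λ { zero → h0≡ ; (suc a) → h≡ a }
  where
    f₀ : Fin (suc m) → Fin (suc n)
    f₀ zero    = zero
    f₀ (suc a) = suc (f a)
    inc₀ : IncreasingMap f₀
    inc₀ zero    (suc b) _         = s≤s z≤n
    inc₀ (suc a) (suc b) (s≤s a<b) = s≤s (inc a b a<b)

private
  pairs-tabulate : ∀ {m} (t : Fin m → ℕ) (ps : List (ℕ × ℕ)) → map proj₂ ps ≡ List.tabulate t →
                   Σ (Fin m → ℕ) λ s → ps ≡ List.tabulate (λ a → s a , t a)
  pairs-tabulate {zero}  t []       refl = (λ ()) , refl
  pairs-tabulate {suc m} t (p ∷ ps) eq with s , refl ← pairs-tabulate (λ a → t (suc a)) ps (∷-injectiveʳ eq) =
    (λ { zero → proj₁ p ; (suc a) → s a }) , cong (λ x → (proj₁ p , x) ∷ _) (∷-injectiveˡ eq)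

values : ∀ {k n} → Vec (Fin k) n → List ℕ
values v = List.tabulate (λ i → toℕ (lookup v i))

contains⇒≼ : ∀ {n m} (π : Vec (Fin n) n) (σ : Vec (Fin m) m) → Contains π σ → values σ ≼ values π
contains⇒≼ π σ (f , inc , iff) = occurrence (List.tabulate h)
  (subst (_⊆ values π) (sym (map-tabulate h proj₁)) (⊆-tabulate (λ i → toℕ (lookup π i)) f inc))
  (map-tabulate h proj₂)
  (AllPairs.tabulate⁺-< λ {a} {b} _ → iff a b , iff b a)
  where
    h : Fin _ → ℕ × ℕ
    h a = toℕ (lookup π (f a)) , toℕ (lookup σ a)

≼⇒contains : ∀ {n m} (π : Vec (Fin n) n) (σ : Vec (Fin m) m) → values σ ≼ values π → Contains π σ
≼⇒contains π σ (occurrence ps τ eq s)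
  with p₁ , refl ← pairs-tabulate _ ps eq
  with f , inc , p₁≡ ← ⊆-tabulate⁻ p₁ (λ i → toℕ (lookup π i)) (subst (_⊆ _) (map-tabulate _ proj₁) τ)
  = f , inc , iff
  where
    iff : ∀ a b → (lookup π (f a) Fin.< lookup π (f b)) ⇔ (lookup σ a Fin.< lookup σ b)
    iff a b with Fin.<-cmp a b
    ... | tri< a<b _ _ = subst₂ (λ x y → (x < y) ⇔ _) (p₁≡ a) (p₁≡ b) (proj₁ (AllPairs-tabulate⁻ s a<b))
    ... | tri> _ _ b<a = subst₂ (λ x y → (x < y) ⇔ _) (p₁≡ a) (p₁≡ b) (proj₂ (AllPairs-tabulate⁻ s b<a))
    ... | tri≈ _ refl _ = mk⇔ (λ h → ⊥-elim (<-irrefl refl h)) (λ h → ⊥-elim (<-irrefl refl h))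

isPerm⇔ : ∀ {n} (π : Vec (Fin n) n) → IsPerm π ⇔ IsPermutation n (values π)
isPerm⇔ π = mk⇔
  (λ inj → isPermutation (Unique.tabulate⁺ (λ e → inj (toℕ-injective e)))
                         (All.tabulate⁺ (λ i → toℕ<n (lookup π i))) (length-tabulate _))
  (λ p {i} {j} e → injective (unique p) i j (cong toℕ e))
  where
    injective : AllPairs _ (values π) → ∀ i j → toℕ (lookup π i) ≡ toℕ (lookup π j) → i ≡ j
    injective u i j e with Fin.<-cmp i j
    ... | tri< i<j _ _ = ⊥-elim (AllPairs-tabulate⁻ u i<j e)
    ... | tri≈ _ i≡j _ = i≡j
    ... | tri> _ _ j<i = ⊥-elim (AllPairs-tabulate⁻ u j<i (sym e))

private
  nth : List ℕ → ℕ → ℕ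
  nth []       _       = 0
  nth (x ∷ _)  zero    = x
  nth (_ ∷ xs) (suc k) = nth xs k

  nth-tabulate : ∀ {n} (g : Fin n → ℕ) (i : Fin n) → nth (List.tabulate g) (toℕ i) ≡ g i
  nth-tabulate g zero    = refl
  nth-tabulate g (suc i) = nth-tabulate (λ j → g (suc j)) i

  tabulate-nth : ∀ {n} xs → length xs ≡ n → List.tabulate (λ (i : Fin n) → nth xs (toℕ i)) ≡ xs
  tabulate-nth []       refl = refl
  tabulate-nth (x ∷ xs) refl = cong (x ∷_) (tabulate-nth xs refl)

  nth-bounded : ∀ {n k} xs → All (_< n) xs → k < length xs → nth xs k < n
  nth-bounded {k = zero}  (_ ∷ _)  (x<n ∷ _)   _         = x<n
  nth-bounded {k = suc k} (_ ∷ xs) (_ ∷ xs<n) (s≤s k<) = nth-bounded xs xs<n k<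

  -- out-of-range values are replaced by the position itself
  toFin : ∀ {n} → ℕ → Fin n → Fin n
  toFin {n} x i with x <? n
  ... | yes x<n = fromℕ< x<n
  ... | no  _   = i

  toℕ-toFin : ∀ {n x} (i : Fin n) → x < n → toℕ (toFin x i) ≡ x
  toℕ-toFin {n} {x} i x<n with x <? n
  ... | yes x<n′ = toℕ-fromℕ< x<n′
  ... | no  x≮n  = ⊥-elim (x≮n x<n)

fromValues : (n : ℕ) → List ℕ → Vec (Fin n) n
fromValues n xs = Vec.tabulate λ i → toFin (nth xs (toℕ i)) i

values-fromValues : ∀ {n xs} → IsPermutation n xs → values (fromValues n xs) ≡ xs
values-fromValues {n} {xs} (isPermutation _ xs<n |xs|) =
  trans (tabulate-cong λ i → trans (cong toℕ (Vec.lookup∘tabulate _ i))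
          (toℕ-toFin i (nth-bounded xs xs<n (subst (toℕ i <_) (sym |xs|) (toℕ<n i)))))
        (tabulate-nth xs |xs|)

fromValues-values : ∀ {n} (π : Vec (Fin n) n) → fromValues n (values π) ≡ π
fromValues-values {n} π = trans (Vec.tabulate-cong λ i → toℕ-injective
    (trans (toℕ-toFin i (subst (_< n) (sym (nth-tabulate _ i)) (toℕ<n (lookup π i)))) (nth-tabulate _ i)))
  (Vec.tabulate∘lookup π)

InS⇔Av : ∀ {n} (π : Vec (Fin n) n) → InS n π ⇔ Av classA n (values π)
InS⇔Av π = mk⇔
  (λ (p , ¬132 , ¬54213 , ¬2341) → Equivalence.to (isPerm⇔ π) p ,
     (λ o → ¬132 (≼⇒contains π Defs.p132 o)) ∷ (λ o → ¬54213 (≼⇒contains π Defs.p54213 o)) ∷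
     (λ o → ¬2341 (≼⇒contains π Defs.p2341 o)) ∷ [])
  λ { (p , ¬132 ∷ ¬54213 ∷ ¬2341 ∷ []) → Equivalence.from (isPerm⇔ π) p ,
        (λ c → ¬132 (contains⇒≼ π Defs.p132 c)) , (λ c → ¬54213 (contains⇒≼ π Defs.p54213 c)) ,
        (λ c → ¬2341 (contains⇒≼ π Defs.p2341 c)) }

card : ∀ n → HasCard (InS n) (∣A∣ n)
card n = map (fromValues n) (𝒜 n) ,
  Unique.map⁻ (subst Unique (sym round-trip) (𝒜-unique n)) ,
  (λ π → mk⇔ (sound π) (complete π)) ,
  length-map (fromValues n) (𝒜 n)
  where
    round-trip : map values (map (fromValues n) (𝒜 n)) ≡ 𝒜 n
    round-trip = trans (sym (map-∘ (𝒜 n)))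
      (map-id-local (All.tabulate λ π∈ → values-fromValues (proj₁ (𝒜-sound n π∈))))
    sound : ∀ π → π ∈ map (fromValues n) (𝒜 n) → InS n π
    sound π π∈ with xs , xs∈ , refl ← ∈-map⁻ (fromValues n) π∈ =
      Equivalence.from (InS⇔Av π) (subst (Av classA n) (sym (values-fromValues (proj₁ xsAv))) xsAv)
      where xsAv = 𝒜-sound n xs∈
    complete : ∀ π → InS n π → π ∈ map (fromValues n) (𝒜 n)
    complete π inS = subst (_∈ _) (fromValues-values π)
      (∈-map⁺ (fromValues n) (𝒜-complete n (Equivalence.to (InS⇔Av π) inS)))

theorem4p11 : Σ (ℕ → ℕ) λ a →
    (∀ n → HasCard (InS n) (a n))
    × (∀ n → 2 ≤ n → + (a n) ≡ closedForm n)
    × (∀ n → (denominator ⋆ (λ k → + (a k))) n ≡ numerator n)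
theorem4p11 = ∣A∣ , card , ∣A∣-closedForm , gf
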